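{- For $n\ge0$, $$F_{n+1}=\sum_{k=0}^{n}\binom{n}{k}_{q_1,q_2}\,p_1^{k}p_2^{\,n-k}\,F_kF_{n-k}.$$ Moreover, $\displaystyle\Big(\frac{d}{dx}\Big)_{q_1,q_2}\mathcal{F}(x)=\mathcal{F}(p_1x)\,\mathcal{F}(p_2x)$.
   Context: For $\pi\in\mathfrak{S}_n$ define the statistics: $S_1(\pi)$ = number of pairs of positions $i<j$ with $\pi(i)<\pi(j)$ and no $l$ with $i<l<j$ and $\pi(l)>\pi(j)$; $S_2(\pi)$ = number of pairs $i<j$ with $\pi(i)>\pi(j)$ and no $l$ with $i<l<j$ and $\pi(l)>\pi(i)$; $T_1(\pi)$ = number of triples $i<j<k$ with $\pi(i)<\pi(k)<\pi(j)$ and no $l$ with $i<l<k$, $l\ne j$, $\pi(l)>\pi(j)$; $T_2(\pi)$ = number of triples $i<j<k$ with $\pi(k)<\pi(i)<\pi(j)$ and no $l$ with $i<l<k$, $l\ne j$, $\pi(l)>\pi(j)$. (These are the mesh patterns $(12,\{(1,2)\})$, $(21,\{(1,2)\})$, $(132,\{(1,3),(2,3)\})$, $(231,\{(1,3),(2,3)\})$.) Let $F_n=\sum_{\pi\in\mathfrak{S}_n}p_1^{S_1(\pi)}p_2^{S_2(\pi)}q_1^{T_1(\pi)}q_2^{T_2(\pi)}$ (so $F_0=1$). Let $[m]=q_1^{m-1}+q_1^{m-2}q_2+\cdots+q_2^{m-1}$ for $m\ge1$, $[m]!=[1][2]\cdots[m]$ with $[0]!=1$, and $\binom{n}{k}_{q_1,q_2}=[n]!/([k]![n-k]!)$.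 Let $\mathcal{F}(x)=\sum_{n\ge0}F_nx^n/[n]!$, and define the $q_1,q_2$-derivative by $\big(\frac{d}{dx}\big)_{q_1,q_2}f(x)=\frac{f(q_1x)-f(q_2x)}{q_1x-q_2x}$. -}

module Defs where

open import Data.Nat using (ℕ; zero; suc; _∸_; _<ᵇ_; _≡ᵇ_)
open import Data.Bool using (Bool; true; false; _∧_; not; if_then_else_)
open import Data.Fin using (Fin; toℕ)
open import Data.List using (List; []; _∷_; map; concatMap; allFin; upTo; foldr; length; filter)
import Data.Vec.Functional as VF
open import Data.Product using (_×_; _,_)
open import Algebra.Bundles using (CommutativeRing)

-- Combinatorics on 𝔖ₙ.  A permutation of [n] is an injective map
-- Fin n → Fin n (positions ↦ values).  We enumerate all maps
-- Fin n → Fin n and keep the injective ones.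

all : ∀ {A : Set} → (A → Bool) → List A → Bool
all p = foldr (λ a b → p a ∧ b) true

_<F_ : ∀ {n} → Fin n → Fin n → Bool
a <F b = toℕ a <ᵇ toℕ b

_≡F_ : ∀ {n} → Fin n → Fin n → Bool
a ≡F b = toℕ a ≡ᵇ toℕ b

allMaps : (m n : ℕ) → List (Fin m → Fin n)
allMaps zero    n = (λ ()) ∷ []
allMaps (suc m) n = concatMap (λ f → map (λ x → x VF.∷ f) (allFin n)) (allMaps m n)

isInjective : ∀ {n} → (Fin n → Fin n) → Bool
isInjective {n} π =
  all (λ i → all (λ j → not (π i ≡F π j) Data.Bool.∨ (i ≡F j)) (allFin n)) (allFin n)

perms : (n : ℕ) → List (Fin n → Fin n)
perms n = filter (λ π → Data.Bool.T? (isInjective π)) (allMaps n n)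
  where import Data.Bool

countB : ∀ {A : Set} → (A → Bool) → List A → ℕ
countB p xs = length (filter (λ x → Data.Bool.T? (p x)) xs)
  where import Data.Bool

pairs : (n : ℕ) → List (Fin n × Fin n)
pairs n = concatMap (λ i → map (λ j → (i , j)) (allFin n)) (allFin n)

triples : (n : ℕ) → List (Fin n × Fin n × Fin n)
triples n = concatMap (λ i → concatMap (λ j → map (λ k → (i , j , k)) (allFin n)) (allFin n)) (allFin n)

S₁ : ∀ {n} → (Fin n → Fin n) → ℕ
S₁ {n} π = countB cond (pairs n)
  where
  cond : Fin n × Fin n → Bool
  cond (i , j) = (i <F j) ∧ (π i <F π j) ∧
    all (λ l → not ((i <F l) ∧ (l <F j) ∧ (π j <F π l))) (allFin n)

S₂ : ∀ {n} → (Fin n → Fin n) → ℕ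
S₂ {n} π = countB cond (pairs n)
  where
  cond : Fin n × Fin n → Bool
  cond (i , j) = (i <F j) ∧ (π j <F π i) ∧
    all (λ l → not ((i <F l) ∧ (l <F j) ∧ (π i <F π l))) (allFin n)

T₁ : ∀ {n} → (Fin n → Fin n) → ℕ
T₁ {n} π = countB cond (triples n)
  where
  cond : Fin n × Fin n × Fin n → Bool
  cond (i , j , k) = (i <F j) ∧ (j <F k) ∧ (π i <F π k) ∧ (π k <F π j) ∧
    all (λ l → not ((i <F l) ∧ (l <F k) ∧ not (l ≡F j) ∧ (π j <F π l))) (allFin n)

T₂ : ∀ {n} → (Fin n → Fin n) → ℕ
T₂ {n} π = countB cond (triples n)
  where
  cond : Fin n × Fin n × Fin n → Bool
  cond (i , j , k) = (i <F j) ∧ (j <F k) ∧ (π k <F π i) ∧ (π i <F π j) ∧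
    all (λ l → not ((i <F l) ∧ (l <F k) ∧ not (l ≡F j) ∧ (π j <F π l))) (allFin n)

-- Algebra, evaluated in an arbitrary commutative ring R at values
-- p₁ p₂ q₁ q₂ of the indeterminates.

module Setup {c ℓ} (R : CommutativeRing c ℓ) (p₁ p₂ q₁ q₂ : CommutativeRing.Carrier R) where
  open CommutativeRing R

  pow : Carrier → ℕ → Carrier
  pow x zero    = 1#
  pow x (suc n) = x * pow x n

  Σ : ∀ {A : Set} → List A → (A → Carrier) → Carrier
  Σ xs f = foldr (λ a s → f a + s) 0# xs

  Σ≤ : ℕ → (ℕ → Carrier) → Carrier
  Σ≤ n f = Σ (upTo (suc n)) f

  F : ℕ → Carrier
  F n = Σ (perms n) (λ π → pow p₁ (S₁ π) * pow p₂ (S₂ π) * pow q₁ (T₁ π) * pow q₂ (T₂ π))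

  qint : ℕ → Carrier
  qint m = Σ (upTo m) (λ i → pow q₁ (m ∸ suc i) * pow q₂ i)

  qfact : ℕ → Carrier
  qfact zero    = 1#
  qfact (suc n) = qfact n * qint (suc n)

  -- Given inverses inv m of [m+1], the inverse of [n]! is inv 0 ⋯ inv (n-1).
  invfact : (inv : ℕ → Carrier) → ℕ → Carrier
  invfact inv zero    = 1#
  invfact inv (suc n) = invfact inv n * inv n

  qbinom : (inv : ℕ → Carrier) → ℕ → ℕ → Carrier
  qbinom inv n k = qfact n * (invfact inv k * invfact inv (n ∸ k))

  FPS : Set c
  FPS = ℕ → Carrier

  𝓕 : (inv : ℕ → Carrier) → FPS
  𝓕 inv n = F n * invfact inv n

  scale : Carrier → FPS → FPS
  scale a f n = pow a n * f n

  _·_ : FPS → FPS → FPS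
  (f · g) n = Σ≤ n (λ k → f k * g (n ∸ k))

  -- (d/dx)_{q₁,q₂} f = (f(q₁x) - f(q₂x)) / ((q₁ - q₂) x), where d is
  -- the inverse of (q₁ - q₂).  The numerator has zero constant term, so
  -- division by x is the shift of coefficients.
  qderiv : (d : Carrier) → FPS → FPS
  qderiv d f n = d * (scale q₁ f (suc n) - scale q₂ f (suc n))

-- Write the word of a permutation of {0, …, n} as u n v.  An occurrence of one of the four
-- patterns that uses the maximal letter n is a pair (a, n) with a in u, a pair (n, y) with y in v,
-- or a triple (a, n, y) with a in u and y in v; every other occurrence lies inside u or inside v,
-- and these only depend on the relative order of the letters.  So the weight of the word is
-- p₁^|u| p₂^|v| times q₁, q₂ raised to the numbers of pairs a < y, a > y with a in u and y in v,
-- times the weights of the standardisations of u and v.  Summing over the standardisations gives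
-- F_k F_(n-k); summing over the letter set of u gives a q-binomial coefficient, which satisfies
-- Pascal's recurrence and hence equals [n]! / ([k]! [n-k]!).  The derivative identity is the
-- recurrence read coefficientwise, as the q-derivative maps the coefficient of x^(n+1) to [n+1] times it.
module Submission where

open import Defs
open import Data.Nat using (ℕ; suc; _∸_)
open import Data.Product using (_×_; _,_)
open import Algebra.Bundles using (CommutativeMonoid; CommutativeRing)

module Lists where

  open import Data.Nat using (ℕ; _<_; _≟_)
  open import Data.Nat.Properties using (<⇒≢)
  open import Data.Bool using (true; false)
  open import Data.List using (List; []; _∷_; map; _++_; length; concatMap; upTo; filter)
  open import Data.List.Properties using (length-upTo; filter-notAll)
  open import Data.List.Relation.Unary.All as All using (All; []; _∷_)
  import Data.List.Relation.Unary.All.Properties as All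
  open import Data.List.Relation.Unary.AllPairs using ([]; _∷_)
  open import Data.List.Relation.Unary.Any using (here; there)
  open import Data.List.Relation.Unary.Unique.Propositional using (Unique)
  import Data.List.Relation.Unary.Unique.Propositional.Properties as Unique
  open import Data.List.Membership.Propositional using (_∈_; _∉_; lose)
  open import Data.List.Membership.Propositional.Properties
    using (∈-map⁺; ∈-map⁻; ∈-++⁺ˡ; ∈-++⁺ʳ; ∈-++⁻; ∈-upTo⁺; ∈-upTo⁻; ∈-filter⁺; ∈-filter⁻)
  open import Data.List.Membership.Propositional.Properties.WithK using (unique∧set⇒bag)
  open import Data.List.Membership.DecPropositional _≟_ using (_∈?_)
  open import Data.List.Relation.Binary.BagAndSetEquality using (∼bag⇒↭)
  open import Data.List.Relation.Binary.Permutation.Propositional using (_↭_)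
  open import Data.List.Relation.Binary.Permutation.Propositional.Properties using (↭-length)
  open import Data.Product using (_×_; _,_; proj₁; proj₂)
  open import Data.Sum using (inj₁; inj₂)
  open import Data.Empty using (⊥-elim)
  open import Function using (mk⇔)
  open import Relation.Nullary using (¬_; yes; no; does; Dec)
  open import Relation.Binary.PropositionalEquality

  private variable A B : Set

  unique-map⁺ : ∀ (f : A → B) {xs} → (∀ {x y} → x ∈ xs → y ∈ xs → f x ≡ f y → x ≡ y) → Unique xs → Unique (map f xs)
  unique-map⁺ f {[]}     f-inj []          = []
  unique-map⁺ f {x ∷ xs} f-inj (x∉xs ∷ xs!) =
    All.map⁺ (All.tabulate (λ y∈ fx≡fy → All.lookup x∉xs y∈ (f-inj (here refl) (there y∈) fx≡fy)))
    ∷ unique-map⁺ f (λ x∈ y∈ → f-inj (there x∈) (there y∈)) xs!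

  unique-++⁻ : ∀ (u : List A) {v} → Unique (u ++ v) → Unique u × Unique v × (∀ {x} → x ∈ u → x ∉ v)
  unique-++⁻ []      v!                = [] , v! , λ ()
  unique-++⁻ (a ∷ u) (a∉uv ∷ uv!) with unique-++⁻ u uv!
  ... | u! , v! , disjoint =
    All.++⁻ˡ u a∉uv ∷ u! , v! , λ { (here refl) x∈v → All.lookup a∉uv (∈-++⁺ʳ u x∈v) refl
                                  ; (there x∈u) x∈v → disjoint x∈u x∈v }

  unique-map-filter : ∀ {P : A → Set} (P? : ∀ x → Dec (P x)) (f : A → B) xs →
                      Unique (map f xs) → Unique (map f (filter P? xs))
  unique-map-filter P? f []       []           = []
  unique-map-filter P? f (x ∷ xs) (fx∉ ∷ fxs!) with does (P? x)
  ... | false = unique-map-filter P? f xs fxs!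
  ... | true  = All.map⁺ (All.filter⁺ P? (All.map⁻ fx∉)) ∷ unique-map-filter P? f xs fxs!

  unique-sameElements⇒↭ : ∀ {xs ys : List A} → Unique xs → Unique ys →
                          (∀ {x} → x ∈ xs → x ∈ ys) → (∀ {x} → x ∈ ys → x ∈ xs) → xs ↭ ys
  unique-sameElements⇒↭ xs! ys! ⊆ ⊇ = ∼bag⇒↭ (unique∧set⇒bag xs! ys! (mk⇔ ⊆ ⊇))

  unique-bounded⇒↭upTo : ∀ n {w} → Unique w → All (_< n) w → length w ≡ n → w ↭ upTo n
  unique-bounded⇒↭upTo n {w} w! w<n |w|≡n =
    unique-sameElements⇒↭ w! (Unique.upTo⁺ n) (λ x∈w → ∈-upTo⁺ (All.lookup w<n x∈w)) (λ x∈ → surjective (∈-upTo⁻ x∈))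
    where
    present : List ℕ
    present = filter (_∈? w) (upTo n)
    w↭present : w ↭ present
    w↭present = unique-sameElements⇒↭ w! (Unique.filter⁺ (_∈? w) (Unique.upTo⁺ n))
      (λ x∈w → ∈-filter⁺ (_∈? w) (∈-upTo⁺ (All.lookup w<n x∈w)) x∈w)
      (λ x∈ → proj₂ (∈-filter⁻ (_∈? w) {xs = upTo n} x∈))
    surjective : ∀ {x} → x < n → x ∈ w
    surjective {x} x<n with x ∈? w
    ... | yes x∈w = x∈w
    ... | no  x∉w = ⊥-elim (<⇒≢ (subst₂ _<_ (trans (sym (↭-length w↭present)) |w|≡n) (length-upTo n)
                      (filter-notAll (_∈? w) (upTo n) (lose (∈-upTo⁺ x<n) x∉w))) refl)

  dependentPairs : List A → (A → List B) → List (A × B)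
  dependentPairs xs g = concatMap (λ x → map (x ,_) (g x)) xs

  ∈-dependentPairs⁻ : ∀ xs (g : A → List B) {x y} → (x , y) ∈ dependentPairs xs g → x ∈ xs × y ∈ g x
  ∈-dependentPairs⁻ (z ∷ xs) g p∈ with ∈-++⁻ (map (z ,_) (g z)) p∈
  ... | inj₁ p∈z with ∈-map⁻ (z ,_) p∈z
  ...   | _ , y∈ , refl = here refl , y∈
  ∈-dependentPairs⁻ (z ∷ xs) g p∈ | inj₂ p∈xs with ∈-dependentPairs⁻ xs g p∈xs
  ...   | x∈ , y∈ = there x∈ , y∈

  ∈-dependentPairs⁺ : ∀ xs (g : A → List B) {x y} → x ∈ xs → y ∈ g x → (x , y) ∈ dependentPairs xs g
  ∈-dependentPairs⁺ (z ∷ xs) g (here refl) y∈ = ∈-++⁺ˡ (∈-map⁺ (z ,_) y∈)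
  ∈-dependentPairs⁺ (z ∷ xs) g (there x∈)  y∈ = ∈-++⁺ʳ (map (z ,_) (g z)) (∈-dependentPairs⁺ xs g x∈ y∈)

  dependentPairs-unique : ∀ {xs} (g : A → List B) → Unique xs → (∀ x → Unique (g x)) → Unique (dependentPairs xs g)
  dependentPairs-unique {xs = []}     g []          g! = []
  dependentPairs-unique {xs = x ∷ xs} g (x∉ ∷ xs!) g! =
    Unique.++⁺ (unique-map⁺ (x ,_) (λ _ _ → cong proj₂) (g! x)) (dependentPairs-unique g xs! g!) disjoint
    where
    disjoint : ∀ {p} → ¬ (p ∈ map (x ,_) (g x) × p ∈ dependentPairs xs g)
    disjoint (p∈x , p∈xs) with ∈-map⁻ (x ,_) p∈x
    ... | _ , _ , refl = All.lookup x∉ (proj₁ (∈-dependentPairs⁻ xs g p∈xs)) refl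

module ListSum {c ℓ} (M : CommutativeMonoid c ℓ) where

  open import Data.List using (List; []; _∷_; map; _++_; concatMap)
  open import Data.List.Membership.Propositional using (_∈_)
  open import Data.List.Relation.Unary.Any using (here; there)
  open import Data.List.Relation.Binary.Permutation.Propositional as ↭ using (_↭_)
  open import Data.Product using (_×_; _,_)
  open import Function using (_∘_)
  import Relation.Binary.PropositionalEquality as ≡

  open Lists using (dependentPairs)

  open CommutativeMonoid M
  open import Relation.Binary.Reasoning.Setoid setoid

  private variable A B : Set

  Σ : List A → (A → Carrier) → Carrier
  Σ xs f = Data.List.foldr (λ a s → f a ∙ s) ε xs

  Σ-cong-∈ : ∀ (xs : List A) {f g : A → Carrier} → (∀ {x} → x ∈ xs → f x ≈ g x) → Σ xs f ≈ Σ xs g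
  Σ-cong-∈ []       f≈g = refl
  Σ-cong-∈ (x ∷ xs) f≈g = ∙-cong (f≈g (here ≡.refl)) (Σ-cong-∈ xs (f≈g ∘ there))

  Σ-cong : ∀ (xs : List A) {f g : A → Carrier} → (∀ x → f x ≈ g x) → Σ xs f ≈ Σ xs g
  Σ-cong xs f≈g = Σ-cong-∈ xs (λ {x} _ → f≈g x)

  Σ-ε : ∀ (xs : List A) → Σ xs (λ _ → ε) ≈ ε
  Σ-ε []       = refl
  Σ-ε (x ∷ xs) = trans (identityˡ _) (Σ-ε xs)

  Σ-++ : ∀ (xs ys : List A) (f : A → Carrier) → Σ (xs ++ ys) f ≈ Σ xs f ∙ Σ ys f
  Σ-++ []       ys f = sym (identityˡ _)
  Σ-++ (x ∷ xs) ys f = trans (∙-congˡ (Σ-++ xs ys f)) (sym (assoc _ _ _))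

  Σ-distrib-∙ : ∀ (xs : List A) (f g : A → Carrier) → Σ xs (λ x → f x ∙ g x) ≈ Σ xs f ∙ Σ xs g
  Σ-distrib-∙ []       f g = sym (identityˡ ε)
  Σ-distrib-∙ (x ∷ xs) f g = begin
    (f x ∙ g x) ∙ Σ xs (λ x → f x ∙ g x) ≈⟨ ∙-congˡ (Σ-distrib-∙ xs f g) ⟩
    (f x ∙ g x) ∙ (Σ xs f ∙ Σ xs g)       ≈⟨ assoc _ _ _ ⟩
    f x ∙ (g x ∙ (Σ xs f ∙ Σ xs g))       ≈⟨ ∙-congˡ (trans (sym (assoc _ _ _)) (trans (∙-congʳ (comm _ _)) (assoc _ _ _))) ⟩
    f x ∙ (Σ xs f ∙ (g x ∙ Σ xs g))       ≈⟨ sym (assoc _ _ _) ⟩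
    (f x ∙ Σ xs f) ∙ (g x ∙ Σ xs g)       ∎

  Σ-↭ : ∀ {xs ys : List A} (f : A → Carrier) → xs ↭ ys → Σ xs f ≈ Σ ys f
  Σ-↭ f ↭.refl          = refl
  Σ-↭ f (↭.prep x p)    = ∙-congˡ (Σ-↭ f p)
  Σ-↭ f (↭.swap x y p)  = trans (sym (assoc _ _ _)) (trans (∙-congʳ (comm _ _))
                            (trans (assoc _ _ _) (∙-congˡ (∙-congˡ (Σ-↭ f p)))))
  Σ-↭ f (↭.trans p q)   = trans (Σ-↭ f p) (Σ-↭ f q)

  Σ-map : ∀ (h : A → B) (xs : List A) (f : B → Carrier) → Σ (map h xs) f ≈ Σ xs (f ∘ h)
  Σ-map h []       f = refl
  Σ-map h (x ∷ xs) f = ∙-congˡ (Σ-map h xs f)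

  Σ-concatMap : ∀ (g : A → List B) (xs : List A) (f : B → Carrier) →
                Σ (concatMap g xs) f ≈ Σ xs (λ x → Σ (g x) f)
  Σ-concatMap g []       f = refl
  Σ-concatMap g (x ∷ xs) f = trans (Σ-++ (g x) (concatMap g xs) f) (∙-congˡ (Σ-concatMap g xs f))

  Σ-dependentPairs : ∀ (xs : List A) (g : A → List B) (f : A × B → Carrier) →
                     Σ (dependentPairs xs g) f ≈ Σ xs (λ x → Σ (g x) (λ y → f (x , y)))
  Σ-dependentPairs xs g f = trans (Σ-concatMap _ xs f) (Σ-cong xs (λ x → Σ-map (x ,_) (g x) f))

module Words where

  open import Defs using (all; _<F_; _≡F_; countB; pairs; triples; S₁; S₂; T₁; T₂)
  open import Data.Nat using (ℕ; zero; suc; _+_; _<ᵇ_; _<_; _≤_)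
  open import Data.Nat.Properties using (+-assoc; +-identityʳ; <⇒≤; <⇒<ᵇ; <ᵇ⇒<; <⇒≱; +-0-commutativeMonoid)
  open import Data.Nat.Tactic.RingSolver using (solve-∀)
  open import Data.Bool using (Bool; true; false; _∧_; not; if_then_else_)
  open import Data.Bool.Properties using (∧-identityʳ; ∧-zeroʳ; ∧-assoc; ∧-comm; if-eta; T-≡)
  open import Data.Fin using (Fin; toℕ) renaming (zero to fz; suc to fs)
  open import Data.List using (List; []; _∷_; map; tabulate; allFin; _++_; length; reverseAcc)
  open import Data.List.Relation.Unary.All using (All; []; _∷_)
  import Data.List.Relation.Unary.All as All
  open import Data.List.Relation.Unary.Any using (here; there)
  open import Data.List.Membership.Propositional using (_∈_)
  open import Data.Product using (_×_; _,_)
  open import Data.Empty using (⊥-elim)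
  open import Function using (_∘_; id; Equivalence)
  open import Relation.Binary.PropositionalEquality

  open ListSum +-0-commutativeMonoid using (Σ; Σ-cong; Σ-map; Σ-concatMap)

  𝟙 : Bool → ℕ
  𝟙 true  = 1
  𝟙 false = 0

  Σᶠ : (n : ℕ) → (Fin n → ℕ) → ℕ
  Σᶠ zero    h = 0
  Σᶠ (suc n) h = h fz + Σᶠ n (h ∘ fs)

  allᶠ : (n : ℕ) → (Fin n → Bool) → Bool
  allᶠ zero    q = true
  allᶠ (suc n) q = q fz ∧ allᶠ n (q ∘ fs)

  <ᵇ-true : ∀ {m n} → m < n → (m <ᵇ n) ≡ true
  <ᵇ-true m<n = Equivalence.to T-≡ (<⇒<ᵇ m<n)

  <ᵇ-false : ∀ {m n} → n ≤ m → (m <ᵇ n) ≡ false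
  <ᵇ-false {m} {n} n≤m with m <ᵇ n in eq
  ... | false = refl
  ... | true  = ⊥-elim (<⇒≱ (<ᵇ⇒< m n (Equivalence.from T-≡ eq)) n≤m)

  Σᶠ-cong : ∀ n {h h′ : Fin n → ℕ} → (∀ i → h i ≡ h′ i) → Σᶠ n h ≡ Σᶠ n h′
  Σᶠ-cong zero    h≡h′ = refl
  Σᶠ-cong (suc n) h≡h′ = cong₂ _+_ (h≡h′ fz) (Σᶠ-cong n (h≡h′ ∘ fs))

  Σᶠ-zero : ∀ n → Σᶠ n (λ _ → 0) ≡ 0
  Σᶠ-zero zero    = refl
  Σᶠ-zero (suc n) = Σᶠ-zero n

  Σᶠ-if : ∀ n b (h : Fin n → ℕ) → Σᶠ n (λ i → if b then h i else 0) ≡ (if b then Σᶠ n h else 0)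
  Σᶠ-if n true  h = refl
  Σᶠ-if n false h = Σᶠ-zero n

  allᶠ-true : ∀ n → allᶠ n (λ _ → true) ≡ true
  allᶠ-true zero    = refl
  allᶠ-true (suc n) = allᶠ-true n

  countB-Σ : ∀ {A : Set} (p : A → Bool) xs → countB p xs ≡ Σ xs (𝟙 ∘ p)
  countB-Σ p []       = refl
  countB-Σ p (x ∷ xs) with p x
  ... | true  = cong suc (countB-Σ p xs)
  ... | false = countB-Σ p xs

  Σ-tabulate : ∀ {A : Set} n (f : Fin n → A) (h : A → ℕ) → Σ (tabulate f) h ≡ Σᶠ n (h ∘ f)
  Σ-tabulate zero    f h = refl
  Σ-tabulate (suc n) f h = cong (h (f fz) +_) (Σ-tabulate n (f ∘ fs) h)

  all-allFin : ∀ n (q : Fin n → Bool) → all q (allFin n) ≡ allᶠ n q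
  all-allFin n = go n id
    where
    go : ∀ {A : Set} n (f : Fin n → A) (q : A → Bool) → all q (tabulate f) ≡ allᶠ n (q ∘ f)
    go zero    f q = refl
    go (suc n) f q = cong (q (f fz) ∧_) (go n (f ∘ fs) q)

  countB-pairs : ∀ n (p : Fin n × Fin n → Bool) →
                 countB p (pairs n) ≡ Σᶠ n (λ i → Σᶠ n (λ j → 𝟙 (p (i , j))))
  countB-pairs n p = begin
    countB p (pairs n)                                          ≡⟨ countB-Σ p (pairs n) ⟩
    Σ (pairs n) (𝟙 ∘ p)                                         ≡⟨ Σ-concatMap _ (allFin n) _ ⟩
    Σ (allFin n) (λ i → Σ (map (i ,_) (allFin n)) (𝟙 ∘ p))      ≡⟨ Σ-cong (allFin n) (λ i → trans (Σ-map _ (allFin n) _) (Σ-tabulate n id _)) ⟩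
    Σ (allFin n) (λ i → Σᶠ n (λ j → 𝟙 (p (i , j))))            ≡⟨ Σ-tabulate n id _ ⟩
    Σᶠ n (λ i → Σᶠ n (λ j → 𝟙 (p (i , j))))                    ∎
    where open ≡-Reasoning

  countB-triples : ∀ n (p : Fin n × Fin n × Fin n → Bool) →
                   countB p (triples n) ≡ Σᶠ n (λ i → Σᶠ n (λ j → Σᶠ n (λ k → 𝟙 (p (i , j , k)))))
  countB-triples n p = begin
    countB p (triples n)                                                          ≡⟨ countB-Σ p (triples n) ⟩
    Σ (triples n) (𝟙 ∘ p)                                                         ≡⟨ Σ-concatMap _ (allFin n) _ ⟩
    Σ (allFin n) (λ i → Σ (triplesStartingAt i) (𝟙 ∘ p))                                 ≡⟨ Σ-cong (allFin n) inner ⟩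
    Σ (allFin n) (λ i → Σᶠ n (λ j → Σᶠ n (λ k → 𝟙 (p (i , j , k)))))            ≡⟨ Σ-tabulate n id _ ⟩
    Σᶠ n (λ i → Σᶠ n (λ j → Σᶠ n (λ k → 𝟙 (p (i , j , k)))))                    ∎
    where
    open ≡-Reasoning
    triplesStartingAt : Fin n → List (Fin n × Fin n × Fin n)
    triplesStartingAt i = Data.List.concatMap (λ j → map (λ k → (i , j , k)) (allFin n)) (allFin n)
    inner : ∀ i → Σ (triplesStartingAt i) (𝟙 ∘ p) ≡ Σᶠ n (λ j → Σᶠ n (λ k → 𝟙 (p (i , j , k))))
    inner i = trans (Σ-concatMap _ (allFin n) _)
                (trans (Σ-cong (allFin n) (λ j → trans (Σ-map _ (allFin n) _) (Σ-tabulate n id _)))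
                       (Σ-tabulate n id _))

  -- pairStat P B w counts the pairs i < j with P wᵢ wⱼ and no letter strictly between
  -- them above B wᵢ wⱼ; tripleStat V w counts the triples i < j < k with V wᵢ wⱼ wₖ and
  -- no letter other than wⱼ strictly between wᵢ and wₖ above wⱼ.  In the accumulating
  -- functions, pre is the reversed segment between the first letter a and the current one.

  pairsWithFirst : (P : ℕ → ℕ → Bool) (B : ℕ → ℕ → ℕ) → ℕ → List ℕ → List ℕ → ℕ
  pairsWithFirst P B a pre []      = 0
  pairsWithFirst P B a pre (x ∷ w) =
    𝟙 (P a x ∧ all (λ y → not (B a x <ᵇ y)) pre) + pairsWithFirst P B a (x ∷ pre) w

  pairStat : (P : ℕ → ℕ → Bool) (B : ℕ → ℕ → ℕ) → List ℕ → ℕ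
  pairStat P B []      = 0
  pairStat P B (a ∷ w) = pairsWithFirst P B a [] w + pairStat P B w

  triplesWithFirstTwo : (V : ℕ → ℕ → ℕ → Bool) → ℕ → ℕ → List ℕ → ℕ
  triplesWithFirstTwo V a x []      = 0
  triplesWithFirstTwo V a x (y ∷ w) =
    𝟙 (V a x y) + (if not (x <ᵇ y) then triplesWithFirstTwo V a x w else 0)

  triplesWithFirst : (V : ℕ → ℕ → ℕ → Bool) → ℕ → List ℕ → List ℕ → ℕ
  triplesWithFirst V a pre []      = 0
  triplesWithFirst V a pre (x ∷ w) =
    (if all (λ y → not (x <ᵇ y)) pre then triplesWithFirstTwo V a x w else 0) + triplesWithFirst V a (x ∷ pre) w

  tripleStat : (V : ℕ → ℕ → ℕ → Bool) → List ℕ → ℕ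
  tripleStat V []      = 0
  tripleStat V (a ∷ w) = triplesWithFirst V a [] w + tripleStat V w

  P₁ P₂ : ℕ → ℕ → Bool
  P₁ a b = a <ᵇ b
  P₂ a b = b <ᵇ a

  B₁ B₂ : ℕ → ℕ → ℕ
  B₁ a b = b
  B₂ a b = a

  V₁ V₂ : ℕ → ℕ → ℕ → Bool
  V₁ a b c = (a <ᵇ c) ∧ (c <ᵇ b)
  V₂ a b c = (c <ᵇ a) ∧ (a <ᵇ b)

  s₁ s₂ t₁ t₂ : List ℕ → ℕ
  s₁ = pairStat P₁ B₁
  s₂ = pairStat P₂ B₂
  t₁ = tripleStat V₁
  t₂ = tripleStat V₂

  word : ∀ {m n} → (Fin m → Fin n) → List ℕ
  word f = tabulate (toℕ ∘ f)

  -- The counts of Defs with their sums over positions made recursive: peeling off the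
  -- first position turns them into the letter-by-letter statistics above.

  pairAtᶠ : (P : ℕ → ℕ → Bool) (B : ℕ → ℕ → ℕ) → ℕ → List ℕ → ∀ m → (Fin m → ℕ) → Fin m → ℕ
  pairAtᶠ P B a pre m h j =
    𝟙 (P a (h j) ∧ (all (λ y → not (B a (h j) <ᵇ y)) pre ∧ allᶠ m (λ l → not ((l <F j) ∧ (B a (h j) <ᵇ h l)))))

  pairCountᶠ : (P : ℕ → ℕ → Bool) (B : ℕ → ℕ → ℕ) → ∀ n → (Fin n → ℕ) → ℕ
  pairCountᶠ P B n g = Σᶠ n λ i → Σᶠ n λ j →
    𝟙 ((i <F j) ∧ (P (g i) (g j) ∧ allᶠ n (λ l → not ((i <F l) ∧ (l <F j) ∧ (B (g i) (g j) <ᵇ g l)))))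

  ∧-exchange : ∀ p q r s → (p ∧ (q ∧ (r ∧ s))) ≡ (p ∧ ((r ∧ q) ∧ s))
  ∧-exchange p q r s = cong (p ∧_) (trans (sym (∧-assoc q r s)) (cong (_∧ s) (∧-comm q r)))

  pairsWithFirst-tabulate : ∀ P B a pre m h → Σᶠ m (pairAtᶠ P B a pre m h) ≡ pairsWithFirst P B a pre (tabulate h)
  pairsWithFirst-tabulate P B a pre zero    h = refl
  pairsWithFirst-tabulate P B a pre (suc m) h =
    cong₂ _+_ first (trans (Σᶠ-cong m rest) (pairsWithFirst-tabulate P B a (h fz ∷ pre) m (h ∘ fs)))
    where
    unblocked : Bool
    unblocked = all (λ y → not (B a (h fz) <ᵇ y)) pre
    first : pairAtᶠ P B a pre (suc m) h fz ≡ 𝟙 (P a (h fz) ∧ unblocked)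
    first rewrite allᶠ-true m | ∧-identityʳ unblocked = refl
    rest : ∀ j → pairAtᶠ P B a pre (suc m) h (fs j) ≡ pairAtᶠ P B a (h fz ∷ pre) m (h ∘ fs) j
    rest j = cong 𝟙 (∧-exchange (P a (h (fs j))) (all (λ y → not (B a (h (fs j)) <ᵇ y)) pre) (not (B a (h (fs j)) <ᵇ h fz)) _)

  pairStat-tabulate : ∀ P B n g → pairCountᶠ P B n g ≡ pairStat P B (tabulate g)
  pairStat-tabulate P B zero    g = refl
  pairStat-tabulate P B (suc n) g =
    cong₂ _+_ (pairsWithFirst-tabulate P B (g fz) [] n (g ∘ fs)) (pairStat-tabulate P B n (g ∘ fs))

  closingAtᶠ : (V : ℕ → ℕ → ℕ → Bool) → ℕ → ℕ → ∀ m → (Fin m → ℕ) → Fin m → ℕ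
  closingAtᶠ V a x m h k = 𝟙 (V a x (h k) ∧ allᶠ m (λ l → not ((l <F k) ∧ (x <ᵇ h l))))

  triplesAtᶠ : (V : ℕ → ℕ → ℕ → Bool) → ℕ → List ℕ → ∀ m → (Fin m → ℕ) → Fin m → ℕ
  triplesAtᶠ V a pre m h j = Σᶠ m λ k →
    𝟙 ((j <F k) ∧ (V a (h j) (h k) ∧ (all (λ y → not (h j <ᵇ y)) pre ∧ allᶠ m (λ l → not ((l <F k) ∧ not (l ≡F j) ∧ (h j <ᵇ h l))))))

  tripleCountAtᶠ : (V : ℕ → ℕ → ℕ → Bool) → ∀ n → (Fin n → ℕ) → Fin n → ℕ
  tripleCountAtᶠ V n g i = Σᶠ n λ j → Σᶠ n λ k →
    𝟙 ((i <F j) ∧ (j <F k) ∧ (V (g i) (g j) (g k) ∧ allᶠ n (λ l → not ((i <F l) ∧ (l <F k) ∧ not (l ≡F j) ∧ (g j <ᵇ g l)))))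

  tripleCountᶠ : (V : ℕ → ℕ → ℕ → Bool) → ∀ n → (Fin n → ℕ) → ℕ
  tripleCountᶠ V n g = Σᶠ n (tripleCountAtᶠ V n g)

  𝟙-∧-if : ∀ p q r → 𝟙 (p ∧ (q ∧ r)) ≡ (if q then 𝟙 (p ∧ r) else 0)
  𝟙-∧-if true  true  r = refl
  𝟙-∧-if true  false r = refl
  𝟙-∧-if false true  r = refl
  𝟙-∧-if false false r = refl

  triplesWithFirstTwo-tabulate : ∀ V a x m h →
    Σᶠ m (closingAtᶠ V a x m h) ≡ triplesWithFirstTwo V a x (tabulate h)
  triplesWithFirstTwo-tabulate V a x zero    h = refl
  triplesWithFirstTwo-tabulate V a x (suc m) h = cong₂ _+_ first (begin
    Σᶠ m (λ k → closingAtᶠ V a x (suc m) h (fs k))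
      ≡⟨ Σᶠ-cong m (λ k → 𝟙-∧-if (V a x (h (fs k))) continue _) ⟩
    Σᶠ m (λ k → if continue then closingAtᶠ V a x m (h ∘ fs) k else 0)
      ≡⟨ Σᶠ-if m continue _ ⟩
    (if continue then Σᶠ m (closingAtᶠ V a x m (h ∘ fs)) else 0)
      ≡⟨ cong (λ z → if continue then z else 0) (triplesWithFirstTwo-tabulate V a x m (h ∘ fs)) ⟩
    (if continue then triplesWithFirstTwo V a x (tabulate (h ∘ fs)) else 0) ∎)
    where
    open ≡-Reasoning
    continue : Bool
    continue = not (x <ᵇ h fz)
    first : closingAtᶠ V a x (suc m) h fz ≡ 𝟙 (V a x (h fz))
    first rewrite allᶠ-true m | ∧-identityʳ (V a x (h fz)) = refl

  triplesWithFirst-tabulate : ∀ V a pre m h → Σᶠ m (triplesAtᶠ V a pre m h) ≡ triplesWithFirst V a pre (tabulate h)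
  triplesWithFirst-tabulate V a pre zero    h = refl
  triplesWithFirst-tabulate V a pre (suc m) h =
    cong₂ _+_ first (trans (Σᶠ-cong m rest) (triplesWithFirst-tabulate V a (h fz ∷ pre) m (h ∘ fs)))
    where
    unblocked : Bool
    unblocked = all (λ y → not (h fz <ᵇ y)) pre
    first : triplesAtᶠ V a pre (suc m) h fz ≡ (if unblocked then triplesWithFirstTwo V a (h fz) (tabulate (h ∘ fs)) else 0)
    first = trans (Σᶠ-cong m (λ k → 𝟙-∧-if (V a (h fz) (h (fs k))) unblocked _))
              (trans (Σᶠ-if m unblocked _) (cong (λ z → if unblocked then z else 0)
                (triplesWithFirstTwo-tabulate V a (h fz) m (h ∘ fs))))
    rest : ∀ j → triplesAtᶠ V a pre (suc m) h (fs j) ≡ triplesAtᶠ V a (h fz ∷ pre) m (h ∘ fs) j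
    rest j = Σᶠ-cong m (λ k → cong (λ z → 𝟙 ((j <F k) ∧ z))
      (∧-exchange (V a (h (fs j)) (h (fs k))) (all (λ y → not (h (fs j) <ᵇ y)) pre) (not (h (fs j) <ᵇ h fz)) _))

  tripleStat-tabulate : ∀ V n g → tripleCountᶠ V n g ≡ tripleStat V (tabulate g)
  tripleStat-tabulate V zero    g = refl
  tripleStat-tabulate V (suc n) g =
    cong₂ _+_ (trans (Σᶠ-zero-+ _) (triplesWithFirst-tabulate V (g fz) [] n (g ∘ fs)))
              (trans (Σᶠ-cong n shift) (tripleStat-tabulate V n (g ∘ fs)))
    where
    Σᶠ-zero-+ : ∀ x → Σᶠ n (λ _ → 0) + x ≡ x
    Σᶠ-zero-+ x = cong (_+ x) (Σᶠ-zero n)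
    shift : ∀ i → tripleCountAtᶠ V (suc n) g (fs i) ≡ tripleCountAtᶠ V n (g ∘ fs) i
    shift i = trans (Σᶠ-zero-+ _) (Σᶠ-cong n (λ j → cong (λ b → 𝟙 b + Σᶠ n (later j)) (∧-zeroʳ (i <F j))))
      where
      later : Fin n → Fin n → ℕ
      later j k = 𝟙 ((i <F j) ∧ (j <F k) ∧ (V (g (fs i)) (g (fs j)) (g (fs k))
                    ∧ allᶠ (suc n) (λ l → not ((fs i <F l) ∧ (l <F fs k) ∧ not (l ≡F fs j) ∧ (g (fs j) <ᵇ g l)))))

  countB-pairs≡pairStat : ∀ P B n (g : Fin n → ℕ) →
    countB (λ { (i , j) → (i <F j) ∧ P (g i) (g j) ∧ all (λ l → not ((i <F l) ∧ (l <F j) ∧ (B (g i) (g j) <ᵇ g l))) (allFin n) }) (pairs n)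
    ≡ pairStat P B (tabulate g)
  countB-pairs≡pairStat P B n g =
    trans (countB-pairs n _)
      (trans (Σᶠ-cong n (λ i → Σᶠ-cong n (λ j → cong (λ z → 𝟙 ((i <F j) ∧ (P (g i) (g j) ∧ z))) (all-allFin n _))))
        (pairStat-tabulate P B n g))

  countB-triples≡tripleStat : ∀ (L R : ℕ → ℕ → ℕ → Bool) n (g : Fin n → ℕ) →
    countB (λ { (i , j , k) → (i <F j) ∧ (j <F k) ∧ L (g i) (g j) (g k) ∧ R (g i) (g j) (g k) ∧
                              all (λ l → not ((i <F l) ∧ (l <F k) ∧ not (l ≡F j) ∧ (g j <ᵇ g l))) (allFin n) }) (triples n)
    ≡ tripleStat (λ a b c → L a b c ∧ R a b c) (tabulate g)
  countB-triples≡tripleStat L R n g =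
    trans (countB-triples n _)
      (trans (Σᶠ-cong n (λ i → Σᶠ-cong n (λ j → Σᶠ-cong n (λ k →
         cong (λ z → 𝟙 ((i <F j) ∧ (j <F k) ∧ z))
           (trans (sym (∧-assoc (L (g i) (g j) (g k)) (R (g i) (g j) (g k)) _))
                  (cong (λ z → (L (g i) (g j) (g k) ∧ R (g i) (g j) (g k)) ∧ z) (all-allFin n _)))))))
        (tripleStat-tabulate _ n g))

  S₁≡s₁ : ∀ {n} (π : Fin n → Fin n) → S₁ π ≡ s₁ (word π)
  S₁≡s₁ {n} π = countB-pairs≡pairStat P₁ B₁ n (toℕ ∘ π)

  S₂≡s₂ : ∀ {n} (π : Fin n → Fin n) → S₂ π ≡ s₂ (word π)
  S₂≡s₂ {n} π = countB-pairs≡pairStat P₂ B₂ n (toℕ ∘ π)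

  T₁≡t₁ : ∀ {n} (π : Fin n → Fin n) → T₁ π ≡ t₁ (word π)
  T₁≡t₁ {n} π = countB-triples≡tripleStat (λ a b c → a <ᵇ c) (λ a b c → c <ᵇ b) n (toℕ ∘ π)

  T₂≡t₂ : ∀ {n} (π : Fin n → Fin n) → T₂ π ≡ t₂ (word π)
  T₂≡t₂ {n} π = countB-triples≡tripleStat (λ a b c → c <ᵇ a) (λ a b c → a <ᵇ b) n (toℕ ∘ π)

  All-reverseAcc : ∀ {P : ℕ → Set} acc xs → All P acc → All P xs → All P (reverseAcc acc xs)
  All-reverseAcc acc []       pacc []         = pacc
  All-reverseAcc acc (x ∷ xs) pacc (px ∷ pxs) = All-reverseAcc (x ∷ acc) xs (px ∷ pacc) pxs

  all-true : ∀ (q : ℕ → Bool) xs → All (λ y → q y ≡ true) xs → all q xs ≡ true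
  all-true q []       []           = refl
  all-true q (y ∷ xs) (qy ∷ qxs) rewrite qy = all-true q xs qxs

  all-false : ∀ (q : ℕ → Bool) {x} xs → x ∈ xs → q x ≡ false → all q xs ≡ false
  all-false q (y ∷ xs) (here refl) qx rewrite qx = refl
  all-false q (y ∷ xs) (there x∈) qx rewrite all-false q xs x∈ qx = ∧-zeroʳ (q y)

  not-above : ∀ {M xs} → All (_< M) xs → All (λ y → not (M <ᵇ y) ≡ true) xs
  not-above = All.map (λ y<M → cong not (<ᵇ-false (<⇒≤ y<M)))

  pairsWithFirst-++ : ∀ P B a pre u w →
    pairsWithFirst P B a pre (u ++ w) ≡ pairsWithFirst P B a pre u + pairsWithFirst P B a (reverseAcc pre u) w
  pairsWithFirst-++ P B a pre []      w = refl
  pairsWithFirst-++ P B a pre (x ∷ u) w rewrite pairsWithFirst-++ P B a (x ∷ pre) u w =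
    sym (+-assoc (𝟙 (P a x ∧ all (λ y → not (B a x <ᵇ y)) pre)) _ _)

  pairsWithFirst-blocked : ∀ P B a {M} pre v → M ∈ pre → All (λ x → B a x < M) v → pairsWithFirst P B a pre v ≡ 0
  pairsWithFirst-blocked P B a pre []      M∈ []        = refl
  pairsWithFirst-blocked P B a pre (x ∷ v) M∈ (Bx ∷ Bv)
    rewrite all-false (λ y → not (B a x <ᵇ y)) pre M∈ (cong not (<ᵇ-true Bx))
          | ∧-zeroʳ (P a x) = pairsWithFirst-blocked P B a (x ∷ pre) v (there M∈) Bv

  pairsWithFirst-none : ∀ P B a pre v → All (λ x → P a x ≡ false) v → pairsWithFirst P B a pre v ≡ 0
  pairsWithFirst-none P B a pre []      []         = refl
  pairsWithFirst-none P B a pre (x ∷ v) (Px ∷ Pv) rewrite Px = pairsWithFirst-none P B a (x ∷ pre) v Pv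

  pairsWithFirst-max₂ : ∀ M pre v → All (_< M) pre → All (_< M) v → pairsWithFirst P₂ B₂ M pre v ≡ length v
  pairsWithFirst-max₂ M pre []      pre<M []          = refl
  pairsWithFirst-max₂ M pre (x ∷ v) pre<M (x<M ∷ v<M)
    rewrite <ᵇ-true x<M | all-true (λ y → not (M <ᵇ y)) pre (not-above pre<M) =
    cong suc (pairsWithFirst-max₂ M (x ∷ pre) v (x<M ∷ pre<M) v<M)

  s₁-++-max : ∀ M u v → All (_< M) u → All (_< M) v → s₁ (u ++ M ∷ v) ≡ length u + s₁ u + s₁ v
  s₁-++-max M []      v []          v<M =
    cong (_+ s₁ v) (pairsWithFirst-none P₁ B₁ M [] v (All.map (λ x<M → <ᵇ-false (<⇒≤ x<M)) v<M))
  s₁-++-max M (a ∷ u) v (a<M ∷ u<M) v<M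
    rewrite pairsWithFirst-++ P₁ B₁ a [] u (M ∷ v) | s₁-++-max M u v u<M v<M | <ᵇ-true a<M
          | all-true (λ y → not (M <ᵇ y)) (reverseAcc [] u) (All-reverseAcc [] u [] (not-above u<M))
          | pairsWithFirst-blocked P₁ B₁ a (M ∷ reverseAcc [] u) v (here refl) v<M =
    rearrange (pairsWithFirst P₁ B₁ a [] u) (length u) (s₁ u) (s₁ v)
    where
    rearrange : ∀ c l x y → (c + (1 + 0)) + (l + x + y) ≡ suc l + (c + x) + y
    rearrange = solve-∀

  s₂-++-max : ∀ M u v → All (_< M) u → All (_< M) v → s₂ (u ++ M ∷ v) ≡ length v + s₂ u + s₂ v
  s₂-++-max M []      v []          v<M =
    cong (_+ s₂ v) (trans (pairsWithFirst-max₂ M [] v [] v<M) (sym (+-identityʳ _)))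
  s₂-++-max M (a ∷ u) v (a<M ∷ u<M) v<M
    rewrite pairsWithFirst-++ P₂ B₂ a [] u (M ∷ v) | s₂-++-max M u v u<M v<M | <ᵇ-false (<⇒≤ a<M)
          | pairsWithFirst-blocked P₂ B₂ a (M ∷ reverseAcc [] u) v (here refl) (All.map (λ _ → a<M) v<M) =
    rearrange (pairsWithFirst P₂ B₂ a [] u) (length v) (s₂ u) (s₂ v)
    where
    rearrange : ∀ c l x y → (c + 0) + (l + x + y) ≡ l + (c + x) + y
    rearrange = solve-∀

  triplesWithFirstTwo-++ : ∀ V a x u w →
    triplesWithFirstTwo V a x (u ++ w)
    ≡ triplesWithFirstTwo V a x u + (if all (λ y → not (x <ᵇ y)) u then triplesWithFirstTwo V a x w else 0)
  triplesWithFirstTwo-++ V a x []      w = refl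
  triplesWithFirstTwo-++ V a x (y ∷ u) w with not (x <ᵇ y)
  ... | true  rewrite triplesWithFirstTwo-++ V a x u w = sym (+-assoc (𝟙 (V a x y)) _ _)
  ... | false = sym (+-identityʳ _)

  triplesWithFirstTwo-none : ∀ V a x w → All (λ y → V a x y ≡ false) w → triplesWithFirstTwo V a x w ≡ 0
  triplesWithFirstTwo-none V a x []      []         = refl
  triplesWithFirstTwo-none V a x (y ∷ w) (Vy ∷ Vw)
    rewrite Vy | triplesWithFirstTwo-none V a x w Vw = if-eta (not (x <ᵇ y))

  triplesWithFirstTwo-blocked : ∀ V a x M u v → x < M → V a x M ≡ false →
                                triplesWithFirstTwo V a x (u ++ M ∷ v) ≡ triplesWithFirstTwo V a x u
  triplesWithFirstTwo-blocked V a x M u v x<M VM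
    rewrite triplesWithFirstTwo-++ V a x u (M ∷ v) | VM | <ᵇ-true x<M
          | if-eta (all (λ y → not (x <ᵇ y)) u) {0} = +-identityʳ _

  triplesWithFirstTwo-max : ∀ V a M v → All (_< M) v → triplesWithFirstTwo V a M v ≡ Σ v (λ y → 𝟙 (V a M y))
  triplesWithFirstTwo-max V a M []      []          = refl
  triplesWithFirstTwo-max V a M (y ∷ v) (y<M ∷ v<M) rewrite <ᵇ-false (<⇒≤ y<M) =
    cong (𝟙 (V a M y) +_) (triplesWithFirstTwo-max V a M v v<M)

  triplesWithFirst-blocked : ∀ V a {M} pre v → M ∈ pre → All (_< M) v → triplesWithFirst V a pre v ≡ 0
  triplesWithFirst-blocked V a pre []      M∈ []          = refl
  triplesWithFirst-blocked V a pre (x ∷ v) M∈ (x<M ∷ v<M)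
    rewrite all-false (λ y → not (x <ᵇ y)) pre M∈ (cong not (<ᵇ-true x<M)) =
    triplesWithFirst-blocked V a (x ∷ pre) v (there M∈) v<M

  triplesWithFirst-++-max : ∀ V a M pre u v → (∀ x → x < M → V a x M ≡ false) →
    All (_< M) pre → All (_< M) u → All (_< M) v →
    triplesWithFirst V a pre (u ++ M ∷ v) ≡ triplesWithFirst V a pre u + Σ v (λ y → 𝟙 (V a M y))
  triplesWithFirst-++-max V a M pre [] v VM pre<M [] v<M
    rewrite all-true (λ y → not (M <ᵇ y)) pre (not-above pre<M)
          | triplesWithFirst-blocked V a (M ∷ pre) v (here refl) v<M
          | triplesWithFirstTwo-max V a M v v<M = +-identityʳ _
  triplesWithFirst-++-max V a M pre (x ∷ u) v VM pre<M (x<M ∷ u<M) v<M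
    rewrite triplesWithFirstTwo-blocked V a x M u v x<M (VM x x<M)
          | triplesWithFirst-++-max V a M (x ∷ pre) u v VM (x<M ∷ pre<M) u<M v<M =
    sym (+-assoc (if all (λ y → not (x <ᵇ y)) pre then triplesWithFirstTwo V a x u else 0) _ _)

  triplesWithFirst-none : ∀ V M pre v → (∀ x y → x < M → y < M → V M x y ≡ false) → All (_< M) v →
                          triplesWithFirst V M pre v ≡ 0
  triplesWithFirst-none V M pre []      VM []          = refl
  triplesWithFirst-none V M pre (x ∷ v) VM (x<M ∷ v<M)
    rewrite triplesWithFirstTwo-none V M x v (All.map (VM x _ x<M) v<M)
          | triplesWithFirst-none V M (x ∷ pre) v VM v<M = trans (+-identityʳ _) (if-eta _)

  -- The hypotheses say that the maximal letter can only be the middle letter of the pattern.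
  tripleStat-++-max : ∀ V M u v → (∀ a x → a < M → x < M → V a x M ≡ false) → (∀ x y → x < M → y < M → V M x y ≡ false) →
    All (_< M) u → All (_< M) v →
    tripleStat V (u ++ M ∷ v) ≡ Σ u (λ a → Σ v (λ y → 𝟙 (V a M y))) + tripleStat V u + tripleStat V v
  tripleStat-++-max V M [] v V-M V-first [] v<M = cong (_+ tripleStat V v) (triplesWithFirst-none V M [] v V-first v<M)
  tripleStat-++-max V M (a ∷ u) v V-M V-first (a<M ∷ u<M) v<M
    rewrite triplesWithFirst-++-max V a M [] u v (λ x → V-M a x a<M) [] u<M v<M
          | tripleStat-++-max V M u v V-M V-first u<M v<M =
    rearrange (triplesWithFirst V a [] u) (Σ v (λ y → 𝟙 (V a M y))) (Σ u (λ a → Σ v (λ y → 𝟙 (V a M y))))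
              (tripleStat V u) (tripleStat V v)
    where
    rearrange : ∀ d s σ t w → (d + s) + (σ + t + w) ≡ (s + σ) + (d + t) + w
    rearrange = solve-∀

  module _ {S : ℕ → Set} {e : ℕ → ℕ} (e-<ᵇ : ∀ {x y} → S x → S y → (e x <ᵇ e y) ≡ (x <ᵇ y)) where

    private
      all-map : ∀ (q q′ : ℕ → Bool) pre → All S pre → (∀ {y} → S y → q (e y) ≡ q′ y) → all q (map e pre) ≡ all q′ pre
      all-map q q′ []        []            q≡q′ = refl
      all-map q q′ (y ∷ pre) (Sy ∷ Spre) q≡q′ = cong₂ _∧_ (q≡q′ Sy) (all-map q q′ pre Spre q≡q′)

    module _ (P : ℕ → ℕ → Bool) (B : ℕ → ℕ → ℕ)
             (P-e : ∀ {a x} → S a → S x → P (e a) (e x) ≡ P a x)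
             (B-e : ∀ {a x y} → S a → S x → S y → (B (e a) (e x) <ᵇ e y) ≡ (B a x <ᵇ y)) where

      pairsWithFirst-map : ∀ a pre w → S a → All S pre → All S w →
                           pairsWithFirst P B (e a) (map e pre) (map e w) ≡ pairsWithFirst P B a pre w
      pairsWithFirst-map a pre []      Sa Spre []        = refl
      pairsWithFirst-map a pre (x ∷ w) Sa Spre (Sx ∷ Sw) =
        cong₂ _+_ (cong 𝟙 (cong₂ _∧_ (P-e Sa Sx) (all-map _ _ pre Spre (λ Sy → cong not (B-e Sa Sx Sy)))))
                  (pairsWithFirst-map a (x ∷ pre) w Sa (Sx ∷ Spre) Sw)

      pairStat-map : ∀ w → All S w → pairStat P B (map e w) ≡ pairStat P B w
      pairStat-map []      []        = refl
      pairStat-map (a ∷ w) (Sa ∷ Sw) = cong₂ _+_ (pairsWithFirst-map a [] w Sa [] Sw) (pairStat-map w Sw)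

    module _ (V : ℕ → ℕ → ℕ → Bool) (V-e : ∀ {a x y} → S a → S x → S y → V (e a) (e x) (e y) ≡ V a x y) where

      triplesWithFirstTwo-map : ∀ a x w → S a → S x → All S w →
                                triplesWithFirstTwo V (e a) (e x) (map e w) ≡ triplesWithFirstTwo V a x w
      triplesWithFirstTwo-map a x []      Sa Sx []        = refl
      triplesWithFirstTwo-map a x (y ∷ w) Sa Sx (Sy ∷ Sw)
        rewrite V-e Sa Sx Sy | e-<ᵇ Sx Sy | triplesWithFirstTwo-map a x w Sa Sx Sw = refl

      triplesWithFirst-map : ∀ a pre w → S a → All S pre → All S w →
                             triplesWithFirst V (e a) (map e pre) (map e w) ≡ triplesWithFirst V a pre w
      triplesWithFirst-map a pre []      Sa Spre []        = refl
      triplesWithFirst-map a pre (x ∷ w) Sa Spre (Sx ∷ Sw)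
        rewrite all-map (λ y → not (e x <ᵇ y)) (λ y → not (x <ᵇ y)) pre Spre (λ Sy → cong not (e-<ᵇ Sx Sy))
              | triplesWithFirstTwo-map a x w Sa Sx Sw | triplesWithFirst-map a (x ∷ pre) w Sa (Sx ∷ Spre) Sw = refl

      tripleStat-map : ∀ w → All S w → tripleStat V (map e w) ≡ tripleStat V w
      tripleStat-map []      []        = refl
      tripleStat-map (a ∷ w) (Sa ∷ Sw) = cong₂ _+_ (triplesWithFirst-map a [] w Sa [] Sw) (tripleStat-map w Sw)

    s₁-map : ∀ w → All S w → s₁ (map e w) ≡ s₁ w
    s₁-map = pairStat-map P₁ B₁ e-<ᵇ (λ _ Sx Sy → e-<ᵇ Sx Sy)

    s₂-map : ∀ w → All S w → s₂ (map e w) ≡ s₂ w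
    s₂-map = pairStat-map P₂ B₂ (λ Sa Sx → e-<ᵇ Sx Sa) (λ Sa _ Sy → e-<ᵇ Sa Sy)

    t₁-map : ∀ w → All S w → t₁ (map e w) ≡ t₁ w
    t₁-map = tripleStat-map V₁ (λ Sa Sx Sy → cong₂ _∧_ (e-<ᵇ Sa Sy) (e-<ᵇ Sy Sx))

    t₂-map : ∀ w → All S w → t₂ (map e w) ≡ t₂ w
    t₂-map = tripleStat-map V₂ (λ Sa Sx Sy → cong₂ _∧_ (e-<ᵇ Sy Sa) (e-<ᵇ Sa Sx))

module Subsets where

  open import Data.Nat using (ℕ; zero; suc; _+_; _∸_; _<ᵇ_; _<_; z≤n; s≤s; _≟_)
  open import Data.Nat.Properties using (<-cmp; <⇒≢; <⇒≤; ≤-refl; suc-injective; +-suc; m<n⇒m<1+n; m+n∸m≡n)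
  open import Data.Bool using (Bool; true; false; not)
  open import Data.List using (List; []; _∷_; map; _++_; length; upTo; applyUpTo)
  open import Data.List.Properties using (length-map; length-applyUpTo; map-upTo; map-∘; map-id-local; ∷-injectiveʳ)
  open import Data.List.Relation.Unary.All as All using (All; []; _∷_)
  import Data.List.Relation.Unary.All.Properties as All
  open import Data.List.Relation.Unary.AllPairs as AllPairs using (AllPairs; []; _∷_)
  import Data.List.Relation.Unary.AllPairs.Properties as AllPairs
  open import Data.List.Relation.Unary.Any using (here; there)
  open import Data.List.Relation.Unary.Unique.Propositional using (Unique)
  import Data.List.Relation.Unary.Unique.Propositional.Properties as Unique
  open import Data.List.Membership.Propositional using (_∈_)
  open import Data.List.Membership.Propositional.Properties using (∈-map⁺; ∈-map⁻; ∈-++⁺ˡ; ∈-++⁺ʳ; ∈-++⁻)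
  open import Data.Product using (_×_; _,_; proj₂)
  open import Data.List.Membership.DecPropositional _≟_ using (_∈?_)
  open import Data.Sum using (inj₁; inj₂)
  open import Data.Empty using (⊥-elim)
  open import Function using (_∘_; id)
  open import Relation.Nullary using (¬_; yes; no; does)
  open import Relation.Binary.Definitions using (tri<; tri≈; tri>)
  open import Relation.Binary.PropositionalEquality

  open Words using (<ᵇ-true; <ᵇ-false)
  open Lists using (unique-map⁺)

  -- Out of range, nth returns the junk value 0 and indexOf the length.
  nth : List ℕ → ℕ → ℕ
  nth []      i       = 0
  nth (y ∷ A) zero    = y
  nth (y ∷ A) (suc i) = nth A i

  indexOf : List ℕ → ℕ → ℕ
  indexOf []      x = 0
  indexOf (y ∷ A) x with y ≟ x
  ... | yes _ = 0
  ... | no  _ = suc (indexOf A x)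

  nth-indexOf : ∀ A {x} → x ∈ A → nth A (indexOf A x) ≡ x
  nth-indexOf (y ∷ A) {x} x∈ with y ≟ x | x∈
  ... | yes y≡x | _          = y≡x
  ... | no  y≢x | here x≡y   = ⊥-elim (y≢x (sym x≡y))
  ... | no  y≢x | there x∈A  = nth-indexOf A x∈A

  indexOf-< : ∀ A {x} → x ∈ A → indexOf A x < length A
  indexOf-< (y ∷ A) {x} x∈ with y ≟ x | x∈
  ... | yes _   | _          = s≤s z≤n
  ... | no  y≢x | here x≡y   = ⊥-elim (y≢x (sym x≡y))
  ... | no  y≢x | there x∈A  = s≤s (indexOf-< A x∈A)

  nth-∈ : ∀ A {i} → i < length A → nth A i ∈ A
  nth-∈ (y ∷ A) {zero}  _         = here refl
  nth-∈ (y ∷ A) {suc i} (s≤s i<) = there (nth-∈ A i<)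

  indexOf-nth : ∀ A {i} → Unique A → i < length A → indexOf A (nth A i) ≡ i
  indexOf-nth (y ∷ A) {zero}  _           _         with y ≟ y
  ... | yes _   = refl
  ... | no  y≢y = ⊥-elim (y≢y refl)
  indexOf-nth (y ∷ A) {suc i} (y∉ ∷ A!) (s≤s i<) with y ≟ nth A i
  ... | yes y≡ = ⊥-elim (All.lookup y∉ (nth-∈ A i<) y≡)
  ... | no  _  = cong suc (indexOf-nth A A! i<)

  indexOf-injective : ∀ A {x y} → x ∈ A → y ∈ A → indexOf A x ≡ indexOf A y → x ≡ y
  indexOf-injective A x∈ y∈ eq = trans (sym (nth-indexOf A x∈)) (trans (cong (nth A) eq) (nth-indexOf A y∈))

  nth-injective : ∀ A {i j} → Unique A → i < length A → j < length A → nth A i ≡ nth A j → i ≡ j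
  nth-injective A A! i< j< eq = trans (sym (indexOf-nth A A! i<)) (trans (cong (indexOf A) eq) (indexOf-nth A A! j<))

  map-nth-upTo : ∀ A → map (nth A) (upTo (length A)) ≡ A
  map-nth-upTo A = trans (map-upTo (nth A) (length A)) (applyUpTo-nth A)
    where
    applyUpTo-nth : ∀ A → applyUpTo (nth A) (length A) ≡ A
    applyUpTo-nth []      = refl
    applyUpTo-nth (y ∷ A) = cong (y ∷_) (applyUpTo-nth A)

  map-nth-unique : ∀ B {ρ} → Unique B → Unique ρ → All (_< length B) ρ → Unique (map (nth B) ρ)
  map-nth-unique B B! ρ! ρ<|B| =
    unique-map⁺ (nth B) (λ i∈ j∈ → nth-injective B B! (All.lookup ρ<|B| i∈) (All.lookup ρ<|B| j∈)) ρ!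

  map-indexOf-nth : ∀ B {ρ} → Unique B → All (_< length B) ρ → map (indexOf B) (map (nth B) ρ) ≡ ρ
  map-indexOf-nth B B! ρ<|B| =
    trans (sym (map-∘ _)) (map-id-local (All.map (indexOf-nth B B!) ρ<|B|))

  map-nth-indexOf : ∀ ρ {B} → (∀ {x} → x ∈ ρ → x ∈ B) → map (nth B) (map (indexOf B) ρ) ≡ ρ
  map-nth-indexOf ρ {B} ρ⊆B = trans (sym (map-∘ ρ)) (map-id-local (All.tabulate (λ x∈ρ → nth-indexOf B (ρ⊆B x∈ρ))))

  Sorted : List ℕ → Set
  Sorted = AllPairs _<_

  nth-monotone : ∀ A {i j} → Sorted A → i < j → j < length A → nth A i < nth A j
  nth-monotone (y ∷ A) {zero}  {suc j} (y< ∷ _) _         (s≤s j<) = All.lookup y< (nth-∈ A j<)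
  nth-monotone (y ∷ A) {suc i} {suc j} (_ ∷ A↑) (s≤s i<j) (s≤s j<) = nth-monotone A A↑ i<j j<

  nth-<ᵇ : ∀ A {i j} → Sorted A → i < length A → j < length A → (nth A i <ᵇ nth A j) ≡ (i <ᵇ j)
  nth-<ᵇ A {i} {j} A↑ i< j< with <-cmp i j
  ... | tri< i<j _ _  = trans (<ᵇ-true (nth-monotone A A↑ i<j j<)) (sym (<ᵇ-true i<j))
  ... | tri≈ _ refl _ = trans (<ᵇ-false {nth A i} ≤-refl) (sym (<ᵇ-false {i} ≤-refl))
  ... | tri> _ _ j<i  = trans (<ᵇ-false (<⇒≤ (nth-monotone A A↑ j<i i<))) (sym (<ᵇ-false (<⇒≤ j<i)))

  -- A subset of {0, …, n-1} is encoded by its characteristic bit string of length n.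
  bit : List Bool → ℕ → Bool
  bit []      x       = false
  bit (b ∷ s) zero    = b
  bit (b ∷ s) (suc x) = bit s x

  positions : (Bool → Bool) → List Bool → List ℕ
  positions t []      = []
  positions t (b ∷ s) with t b
  ... | true  = 0 ∷ map suc (positions t s)
  ... | false = map suc (positions t s)

  trues falses : List Bool → List ℕ
  trues  = positions id
  falses = positions not

  ∈positions⁻ : ∀ t s {x} → x ∈ positions t s → x < length s × t (bit s x) ≡ true
  ∈positions⁻ t (b ∷ s) {x} x∈ with t b in tb
  ∈positions⁻ t (b ∷ s) (here refl) | true  = s≤s z≤n , tb
  ∈positions⁻ t (b ∷ s) (there x∈) | true  with ∈-map⁻ suc x∈
  ... | y , y∈ , refl with ∈positions⁻ t s y∈
  ...   | y< , ty = s≤s y< , ty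
  ∈positions⁻ t (b ∷ s) x∈          | false with ∈-map⁻ suc x∈
  ... | y , y∈ , refl with ∈positions⁻ t s y∈
  ...   | y< , ty = s≤s y< , ty

  ∈positions⁺ : ∀ t s {x} → x < length s → t (bit s x) ≡ true → x ∈ positions t s
  ∈positions⁺ t (b ∷ s) {zero}  _        tb rewrite tb = here refl
  ∈positions⁺ t (b ∷ s) {suc x} (s≤s x<) tx with t b
  ... | true  = there (∈-map⁺ suc (∈positions⁺ t s x< tx))
  ... | false = ∈-map⁺ suc (∈positions⁺ t s x< tx)

  positions-sorted : ∀ t s → Sorted (positions t s)
  positions-sorted t []      = []
  positions-sorted t (b ∷ s) with t b
  ... | true  = All.map⁺ (All.tabulate {xs = positions t s} (λ _ → s≤s z≤n)) ∷ AllPairs.map⁺ (AllPairs.map s≤s (positions-sorted t s))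
  ... | false = AllPairs.map⁺ (AllPairs.map s≤s (positions-sorted t s))

  positions-unique : ∀ t s → Unique (positions t s)
  positions-unique t s = AllPairs.map <⇒≢ (positions-sorted t s)

  length-trues+falses : ∀ s → length (trues s) + length (falses s) ≡ length s
  length-trues+falses []          = refl
  length-trues+falses (true ∷ s)  rewrite length-map suc (trues s) | length-map suc (falses s) =
    cong suc (length-trues+falses s)
  length-trues+falses (false ∷ s) rewrite length-map suc (trues s) | length-map suc (falses s) =
    trans (+-suc _ _) (cong suc (length-trues+falses s))

  bit-ext : ∀ s s′ → length s ≡ length s′ → (∀ x → x < length s → bit s x ≡ bit s′ x) → s ≡ s′
  bit-ext []      []        _  _ = refl
  bit-ext (b ∷ s) (b′ ∷ s′) eq bits≡ =
    cong₂ _∷_ (bits≡ 0 (s≤s z≤n)) (bit-ext s s′ (suc-injective eq) (λ x x< → bits≡ (suc x) (s≤s x<)))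

  bit-applyUpTo : ∀ p n {x} → x < n → bit (applyUpTo p n) x ≡ p x
  bit-applyUpTo p (suc n) {zero}  _        = refl
  bit-applyUpTo p (suc n) {suc x} (s≤s x<) = bit-applyUpTo (p ∘ suc) n x<

  subsets : ℕ → ℕ → List (List Bool)
  subsets zero    zero    = [] ∷ []
  subsets zero    (suc k) = []
  subsets (suc n) zero    = map (false ∷_) (subsets n zero)
  subsets (suc n) (suc k) = map (false ∷_) (subsets n (suc k)) ++ map (true ∷_) (subsets n k)

  subsets-empty : ∀ n k → n < k → subsets n k ≡ []
  subsets-empty zero    (suc k) _         = refl
  subsets-empty (suc n) (suc k) (s≤s n<k)
    rewrite subsets-empty n (suc k) (m<n⇒m<1+n n<k) | subsets-empty n k n<k = refl

  length-trues-true : ∀ s → length (trues (true ∷ s)) ≡ suc (length (trues s))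
  length-trues-true s = cong suc (length-map suc (trues s))

  length-trues-false : ∀ s → length (trues (false ∷ s)) ≡ length (trues s)
  length-trues-false s = length-map suc (trues s)

  ∈subsets⁻ : ∀ n k {s} → s ∈ subsets n k → length s ≡ n × length (trues s) ≡ k
  ∈subsets⁻ zero    zero    (here refl) = refl , refl
  ∈subsets⁻ (suc n) zero    s∈ with ∈-map⁻ (false ∷_) s∈
  ... | s , s∈′ , refl with ∈subsets⁻ n zero s∈′
  ...   | |s| , |A| = cong suc |s| , trans (length-trues-false s) |A|
  ∈subsets⁻ (suc n) (suc k) s∈ with ∈-++⁻ (map (false ∷_) (subsets n (suc k))) s∈
  ... | inj₁ s∈₀ with ∈-map⁻ (false ∷_) s∈₀
  ...   | s , s∈′ , refl with ∈subsets⁻ n (suc k) s∈′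
  ...     | |s| , |A| = cong suc |s| , trans (length-trues-false s) |A|
  ∈subsets⁻ (suc n) (suc k) s∈ | inj₂ s∈₁ with ∈-map⁻ (true ∷_) s∈₁
  ...   | s , s∈′ , refl with ∈subsets⁻ n k s∈′
  ...     | |s| , |A| = cong suc |s| , trans (length-trues-true s) (cong suc |A|)

  ∈subsets⁺ : ∀ n k s → length s ≡ n → length (trues s) ≡ k → s ∈ subsets n k
  ∈subsets⁺ zero    zero    []          refl refl = here refl
  ∈subsets⁺ (suc n) zero    (false ∷ s) |s| |A| =
    ∈-map⁺ (false ∷_) (∈subsets⁺ n zero s (suc-injective |s|) (trans (sym (length-trues-false s)) |A|))
  ∈subsets⁺ (suc n) (suc k) (false ∷ s) |s| |A| =
    ∈-++⁺ˡ (∈-map⁺ (false ∷_) (∈subsets⁺ n (suc k) s (suc-injective |s|) (trans (sym (length-trues-false s)) |A|)))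
  ∈subsets⁺ (suc n) (suc k) (true ∷ s)  |s| |A| =
    ∈-++⁺ʳ (map (false ∷_) (subsets n (suc k)))
      (∈-map⁺ (true ∷_) (∈subsets⁺ n k s (suc-injective |s|) (suc-injective (trans (sym (length-trues-true s)) |A|))))
  ∈subsets⁺ (suc n) zero    (true ∷ s)  |s| |A| with () ← trans (sym (length-trues-true s)) |A|

  subsets-unique : ∀ n k → Unique (subsets n k)
  subsets-unique zero    zero    = [] ∷ []
  subsets-unique zero    (suc k) = []
  subsets-unique (suc n) zero    = unique-map⁺ (false ∷_) (λ _ _ → ∷-injectiveʳ) (subsets-unique n zero)
  subsets-unique (suc n) (suc k) =
    Unique.++⁺ (unique-map⁺ (false ∷_) (λ _ _ → ∷-injectiveʳ) (subsets-unique n (suc k)))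
               (unique-map⁺ (true ∷_) (λ _ _ → ∷-injectiveʳ) (subsets-unique n k))
               disjoint
    where
    disjoint : ∀ {s} → ¬ (s ∈ map (false ∷_) (subsets n (suc k)) × s ∈ map (true ∷_) (subsets n k))
    disjoint (s∈₀ , s∈₁) with ∈-map⁻ (false ∷_) s∈₀ | ∈-map⁻ (true ∷_) s∈₁
    ... | _ , _ , refl | _ , _ , ()

  memberBits : ℕ → List ℕ → List Bool
  memberBits n u = applyUpTo (λ x → does (x ∈? u)) n

  length-falses : ∀ n k s → length s ≡ n → length (trues s) ≡ k → length (falses s) ≡ n ∸ k
  length-falses n k s |s| |A| =
    trans (sym (m+n∸m≡n (length (trues s)) (length (falses s)))) (cong₂ _∸_ (trans (length-trues+falses s) |s|) |A|)

  memberBits-trues : ∀ n s u → length s ≡ n → (∀ {x} → x ∈ u → x ∈ trues s) → (∀ {x} → x ∈ trues s → x ∈ u) →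
                  memberBits n u ≡ s
  memberBits-trues n s u |s| u⊆A A⊆u = bit-ext (memberBits n u) s (trans (length-applyUpTo _ n) (sym |s|)) same-bit
    where
    same-bit : ∀ x → x < length (memberBits n u) → bit (memberBits n u) x ≡ bit s x
    same-bit x x< rewrite bit-applyUpTo (λ x → does (x ∈? u)) n (subst (x <_) (length-applyUpTo _ n) x<)
      with x ∈? u | bit s x in sx
    ... | yes x∈u | b     = sym (trans (sym sx) (proj₂ (∈positions⁻ id s (u⊆A x∈u))))
    ... | no  x∉u | false = refl
    ... | no  x∉u | true  = ⊥-elim (x∉u (A⊆u (∈positions⁺ id s x<s sx)))
      where
      x<s : x < length s
      x<s = subst (x <_) (trans (length-applyUpTo _ n) (sym |s|)) x<

module PermWords where

  open import Defs using (allMaps; perms; isInjective; all; _≡F_)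
  open import Data.Nat using (ℕ; zero; suc; _<_)
  open import Data.Nat.Properties using (suc-injective; ≡ᵇ⇒≡; ≡⇒≡ᵇ)
  open import Data.Bool using (Bool; true; false; _∨_; not; T)
  open import Data.Bool.Properties using (T?)
  open import Data.Fin using (Fin; toℕ) renaming (zero to fz; suc to fs)
  open import Data.Fin.Properties using (toℕ-injective; toℕ<n)
  open import Data.List using (List; []; _∷_; map; length; concatMap; upTo; applyUpTo; tabulate; allFin)
  open import Data.List.Properties using (map-concatMap; concatMap-cong; concatMap-map; map-tabulate; length-tabulate; map-∘; ∷-injectiveˡ; ∷-injectiveʳ)
  open import Data.List.Relation.Unary.All as All using (All; []; _∷_)
  import Data.List.Relation.Unary.All.Properties as All
  open import Data.List.Relation.Unary.AllPairs using ([]; _∷_)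
  open import Data.List.Relation.Unary.Any using (here; there)
  open import Data.List.Relation.Unary.Unique.Propositional using (Unique)
  import Data.List.Relation.Unary.Unique.Propositional.Properties as Unique
  open import Data.List.Membership.Propositional using (_∈_; find; lose)
  open import Data.List.Membership.Propositional.Properties
    using (∈-map⁺; ∈-map⁻; ∈-concatMap⁺; ∈-concatMap⁻; ∈-upTo⁺; ∈-upTo⁻; ∈-filter⁺; ∈-filter⁻; ∈-allFin)
  open import Data.List.Relation.Binary.Permutation.Propositional using (_↭_)
  open import Data.Product using (_×_; _,_)
  open import Data.Empty using (⊥-elim)
  open import Function using (_∘_; id)
  open import Relation.Nullary using (¬_; Dec)
  open import Relation.Binary.PropositionalEquality
  import Data.Vec.Functional as VF

  open Words using (word)
  open Lists using (unique-map⁺; unique-map-filter; unique-bounded⇒↭upTo)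

  prefixed : ℕ → List ℕ → List (List ℕ)
  prefixed B w = map (λ x → x ∷ w) (upTo B)

  words : ℕ → ℕ → List (List ℕ)
  words zero    B = [] ∷ []
  words (suc m) B = concatMap (prefixed B) (words m B)

  map-word-allMaps : ∀ m B → map word (allMaps m B) ≡ words m B
  map-word-allMaps zero    B = refl
  map-word-allMaps (suc m) B = begin
    map word (concatMap (λ f → map (VF._∷ f) (allFin B)) (allMaps m B))
      ≡⟨ map-concatMap word _ (allMaps m B) ⟩
    concatMap (λ f → map word (map (VF._∷ f) (allFin B))) (allMaps m B)
      ≡⟨ concatMap-cong (λ f → trans (sym (map-∘ (allFin B))) (trans (map-∘ (allFin B)) (cong (map (_∷ word f)) (allFin-upTo B)))) (allMaps m B) ⟩
    concatMap (λ f → map (_∷ word f) (upTo B)) (allMaps m B)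
      ≡⟨ sym (concatMap-map (prefixed B) word (allMaps m B)) ⟩
    concatMap (prefixed B) (map word (allMaps m B))
      ≡⟨ cong (concatMap (prefixed B)) (map-word-allMaps m B) ⟩
    words (suc m) B ∎
    where
    open ≡-Reasoning
    applyUpTo-tabulate : ∀ (f : ℕ → ℕ) n → applyUpTo f n ≡ tabulate (f ∘ toℕ {n})
    applyUpTo-tabulate f zero    = refl
    applyUpTo-tabulate f (suc n) = cong (f 0 ∷_) (applyUpTo-tabulate (f ∘ suc) n)
    allFin-upTo : ∀ B → map toℕ (allFin B) ≡ upTo B
    allFin-upTo B = trans (map-tabulate id toℕ) (sym (applyUpTo-tabulate id B))

  ∈words⁻ : ∀ m B {w} → w ∈ words m B → length w ≡ m × All (_< B) w
  ∈words⁻ zero    B (here refl) = refl , []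
  ∈words⁻ (suc m) B w∈ with find (∈-concatMap⁻ (prefixed B) {xs = words m B} w∈)
  ... | w′ , w′∈ , w∈′ with ∈-map⁻ (_∷ w′) w∈′ | ∈words⁻ m B w′∈
  ...   | x , x∈ , refl | |w′| , w′<B = cong suc |w′| , ∈-upTo⁻ x∈ ∷ w′<B

  ∈words⁺ : ∀ m B w → length w ≡ m → All (_< B) w → w ∈ words m B
  ∈words⁺ zero    B []      refl []         = here refl
  ∈words⁺ (suc m) B (x ∷ w) |w| (x<B ∷ w<B) =
    ∈-concatMap⁺ (prefixed B) (lose (∈words⁺ m B w (suc-injective |w|) w<B) (∈-map⁺ (_∷ w) (∈-upTo⁺ x<B)))

  words-unique : ∀ m B → Unique (words m B)
  words-unique zero    B = [] ∷ []
  words-unique (suc m) B = extend (words m B) (words-unique m B)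
    where
    extend : ∀ ws → Unique ws → Unique (concatMap (prefixed B) ws)
    extend []       []           = []
    extend (w ∷ ws) (w∉ ∷ ws!) =
      Unique.++⁺ (unique-map⁺ (_∷ w) (λ _ _ → ∷-injectiveˡ) (Unique.upTo⁺ B)) (extend ws ws!) disjoint
      where
      disjoint : ∀ {v} → ¬ (v ∈ prefixed B w × v ∈ concatMap (prefixed B) ws)
      disjoint (v∈₁ , v∈₂) with ∈-map⁻ (_∷ w) v∈₁
      ... | _ , _ , refl with find (∈-concatMap⁻ (prefixed B) {xs = ws} v∈₂)
      ...   | w′ , w′∈ , v∈′ with ∈-map⁻ (_∷ w′) v∈′
      ...     | _ , _ , eq = All.lookup w∉ w′∈ (∷-injectiveʳ eq)

  permWords : ℕ → List (List ℕ)
  permWords n = map word (perms n)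

  IsPermWord : ℕ → List ℕ → Set
  IsPermWord n w = length w ≡ n × All (_< n) w × Unique w

  private
    T-all⁻ : ∀ {A : Set} (q : A → Bool) xs {x} → T (all q xs) → x ∈ xs → T (q x)
    T-all⁻ q (y ∷ xs) t (here refl) with q y
    ... | true = _
    T-all⁻ q (y ∷ xs) t (there x∈)  with q y
    ... | true = T-all⁻ q xs t x∈

    T-all⁺ : ∀ {A : Set} (q : A → Bool) xs → (∀ x → T (q x)) → T (all q xs)
    T-all⁺ q []       _  = _
    T-all⁺ q (y ∷ xs) qs with q y | qs y
    ... | true | _ = T-all⁺ q xs qs

    isInjective⁺ : ∀ {n} (π : Fin n → Fin n) → (∀ {i j} → toℕ (π i) ≡ toℕ (π j) → i ≡ j) → T (isInjective π)
    isInjective⁺ {n} π inj = T-all⁺ _ (allFin n) (λ i → T-all⁺ _ (allFin n) (λ j → pair i j))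
      where
      pair : ∀ i j → T (not (π i ≡F π j) ∨ (i ≡F j))
      pair i j with toℕ (π i) Data.Nat.≡ᵇ toℕ (π j) in eq
      ... | false = _
      ... | true with inj (≡ᵇ⇒≡ _ _ (subst T (sym eq) _))
      ...   | refl = ≡⇒≡ᵇ (toℕ i) (toℕ i) refl

    isInjective⁻ : ∀ {n} (π : Fin n → Fin n) → T (isInjective π) → ∀ {i j} → toℕ (π i) ≡ toℕ (π j) → i ≡ j
    isInjective⁻ {n} π t {i} {j} eq =
      toℕ-injective (≡ᵇ⇒≡ (toℕ i) (toℕ j) (pair (T-all⁻ _ (allFin n) (T-all⁻ _ (allFin n) t (∈-allFin i)) (∈-allFin j))))
      where
      pair : T (not (π i ≡F π j) ∨ (i ≡F j)) → T (i ≡F j)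
      pair t′ rewrite eq with toℕ (π j) Data.Nat.≡ᵇ toℕ (π j) | ≡⇒≡ᵇ (toℕ (π j)) (toℕ (π j)) refl
      ... | true | _ = t′

    injective? : ∀ {n} (π : Fin n → Fin n) → Dec (T (isInjective π))
    injective? π = T? (isInjective π)

  ∈permWords⁻ : ∀ n {w} → w ∈ permWords n → IsPermWord n w
  ∈permWords⁻ n w∈ with ∈-map⁻ word w∈
  ... | π , π∈ , refl with ∈-filter⁻ injective? {xs = allMaps n n} π∈
  ...   | _ , π-inj = length-tabulate _ , All.tabulate⁺ (λ i → toℕ<n (π i)) , Unique.tabulate⁺ (isInjective⁻ π π-inj)

  ∈permWords⁺ : ∀ n {w} → IsPermWord n w → w ∈ permWords n
  ∈permWords⁺ n {w} (|w| , w<n , w!) with ∈-map⁻ word (subst (w ∈_) (sym (map-word-allMaps n n)) (∈words⁺ n n w |w| w<n))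
  ... | π , π∈ , refl = ∈-map⁺ word (∈-filter⁺ injective? π∈ (isInjective⁺ π (tabulate-injective _ w!)))
    where
    tabulate-injective : ∀ {m} (g : Fin m → ℕ) → Unique (tabulate g) → ∀ {i j} → g i ≡ g j → i ≡ j
    tabulate-injective g (g0∉ ∷ g!) {fz}   {fz}   eq = refl
    tabulate-injective g (g0∉ ∷ g!) {fz}   {fs j} eq = ⊥-elim (All.tabulate⁻ g0∉ j eq)
    tabulate-injective g (g0∉ ∷ g!) {fs i} {fz}   eq = ⊥-elim (All.tabulate⁻ g0∉ i (sym eq))
    tabulate-injective g (g0∉ ∷ g!) {fs i} {fs j} eq = cong fs (tabulate-injective (g ∘ fs) g! eq)

  permWords-unique : ∀ n → Unique (permWords n)
  permWords-unique n =
    unique-map-filter injective? word (allMaps n n) (subst Unique (sym (map-word-allMaps n n)) (words-unique n n))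

  permWord↭upTo : ∀ n {w} → IsPermWord n w → w ↭ upTo n
  permWord↭upTo n (|w| , w<n , w!) = unique-bounded⇒↭upTo n w! w<n |w|

module Decomposition where

  open import Data.Nat using (ℕ; suc; _+_; _∸_; _<_; _≤_; s≤s; _≟_)
  open import Data.Nat.Properties
    using (suc-injective; ≤-pred; <-irrefl; n<1+n; m+n∸m≡n; m+[n∸m]≡n; +-suc; m≤m+n; m<n⇒m<1+n; ≤∧≢⇒<)
  open import Data.Bool using (Bool; true; not)
  open import Data.List using (List; []; _∷_; map; _++_; length; upTo)
  open import Data.List.Properties using (length-map; length-++; length-applyUpTo)
  open import Data.List.Relation.Unary.All as All using (All; []; _∷_)
  import Data.List.Relation.Unary.All.Properties as All
  open import Data.List.Relation.Unary.AllPairs using ([]; _∷_)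
  open import Data.List.Relation.Unary.Any using (here; there)
  open import Data.List.Relation.Unary.Unique.Propositional using (Unique)
  import Data.List.Relation.Unary.Unique.Propositional.Properties as Unique
  open import Data.List.Membership.Propositional using (_∈_; _∉_)
  open import Data.List.Membership.Propositional.Properties using (∈-map⁺; ∈-map⁻; ∈-++⁺ˡ; ∈-++⁺ʳ; ∈-upTo⁺; ∈-upTo⁻)
  open import Data.List.Membership.DecPropositional _≟_ using (_∈?_)
  open import Data.List.Relation.Binary.Permutation.Propositional using (_↭_; ↭-sym)
  open import Data.List.Relation.Binary.Permutation.Propositional.Properties using (∈-resp-↭; ↭-length)
  import Data.List.Relation.Binary.Permutation.Propositional.Properties as ↭
  open import Data.Product using (_×_; _,_; proj₁; proj₂; ∃)
  open import Data.Empty using (⊥-elim)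
  open import Function using (_∘_; id)
  open import Relation.Nullary using (yes; no; does)
  open import Relation.Binary.PropositionalEquality

  open Lists
  open Subsets
  open PermWords

  breakAt : ℕ → List ℕ → List ℕ × List ℕ
  breakAt M []      = [] , []
  breakAt M (x ∷ w) with x ≟ M
  ... | yes _ = [] , w
  ... | no  _ = x ∷ proj₁ (breakAt M w) , proj₂ (breakAt M w)

  breakAt-++ : ∀ M u v → M ∉ u → breakAt M (u ++ M ∷ v) ≡ (u , v)
  breakAt-++ M []      v M∉u with M ≟ M
  ... | yes _   = refl
  ... | no  M≢M = ⊥-elim (M≢M refl)
  breakAt-++ M (x ∷ u) v M∉u with x ≟ M
  ... | yes refl = ⊥-elim (M∉u (here refl))
  ... | no  _ rewrite breakAt-++ M u v (M∉u ∘ there) = refl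

  breakAt-∈ : ∀ M w → M ∈ w → proj₁ (breakAt M w) ++ M ∷ proj₂ (breakAt M w) ≡ w
  breakAt-∈ M (x ∷ w) M∈ with x ≟ M | M∈
  ... | yes refl | _          = refl
  ... | no  x≢M  | here refl  = ⊥-elim (x≢M refl)
  ... | no  _    | there M∈w  = cong (x ∷_) (breakAt-∈ M w M∈w)

  -- A shape (k, s, σ, τ) records the position k of the maximal letter n of a permutation word
  -- of length n+1, the letter set s of the part before it, and the standardisations σ, τ of
  -- the parts before and after it.

  Shape : Set
  Shape = ℕ × List Bool × List ℕ × List ℕ

  shapes : ℕ → List Shape
  shapes n =
    dependentPairs (upTo (suc n)) λ k →
    dependentPairs (subsets n k) λ _ →
    dependentPairs (permWords k) λ _ →
    permWords (n ∸ k)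

  IsShape : ℕ → Shape → Set
  IsShape n (k , s , σ , τ) = k < suc n × s ∈ subsets n k × σ ∈ permWords k × τ ∈ permWords (n ∸ k)

  ∈shapes⁻ : ∀ n {t} → t ∈ shapes n → IsShape n t
  ∈shapes⁻ n {k , s , σ , τ} t∈ with ∈-dependentPairs⁻ (upTo (suc n)) _ t∈
  ... | k∈ , t∈₁ with ∈-dependentPairs⁻ (subsets n k) _ t∈₁
  ...   | s∈ , t∈₂ with ∈-dependentPairs⁻ (permWords k) _ t∈₂
  ...     | σ∈ , τ∈ = ∈-upTo⁻ k∈ , s∈ , σ∈ , τ∈

  ∈shapes⁺ : ∀ n {t} → IsShape n t → t ∈ shapes n
  ∈shapes⁺ n {k , s , σ , τ} (k< , s∈ , σ∈ , τ∈) =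
    ∈-dependentPairs⁺ (upTo (suc n)) _ (∈-upTo⁺ k<)
      (∈-dependentPairs⁺ (subsets n k) _ s∈ (∈-dependentPairs⁺ (permWords k) _ σ∈ τ∈))

  shapes-unique : ∀ n → Unique (shapes n)
  shapes-unique n =
    dependentPairs-unique _ (Unique.upTo⁺ (suc n)) λ k →
    dependentPairs-unique _ (subsets-unique n k) λ _ →
    dependentPairs-unique _ (permWords-unique k) λ _ →
    permWords-unique (n ∸ k)

  glue : ℕ → Shape → List ℕ
  glue n (k , s , σ , τ) = map (nth (trues s)) σ ++ n ∷ map (nth (falses s)) τ

  cut : ℕ → List ℕ → List ℕ → Shape
  cut n u v = length u , S , map (indexOf (trues S)) u , map (indexOf (falses S)) v
    where
    S : List Bool
    S = memberBits n u

  decompose : ℕ → List ℕ → Shape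
  decompose n w = cut n (proj₁ (breakAt n w)) (proj₂ (breakAt n w))

  map-nth-permWord↭ : ∀ m B {ρ} → IsPermWord m ρ → length B ≡ m → map (nth B) ρ ↭ B
  map-nth-permWord↭ m B ρ-perm |B| =
    subst (map (nth B) _ ↭_) (trans (cong (map (nth B) ∘ upTo) (sym |B|)) (map-nth-upTo B))
      (↭.map⁺ (nth B) (permWord↭upTo m ρ-perm))

  map-indexOf-permWord : ∀ m B ρ → length B ≡ m → Unique ρ → (∀ {x} → x ∈ ρ → x ∈ B) → length ρ ≡ m →
                          map (indexOf B) ρ ∈ permWords m
  map-indexOf-permWord m B ρ |B| ρ! ρ⊆B |ρ| = ∈permWords⁺ m
    ( trans (length-map (indexOf B) ρ) |ρ|
    , All.map⁺ (All.tabulate (λ x∈ρ → subst (indexOf B _ <_) |B| (indexOf-< B (ρ⊆B x∈ρ))))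
    , unique-map⁺ (indexOf B) (λ x∈ y∈ → indexOf-injective B (ρ⊆B x∈) (ρ⊆B y∈)) ρ! )

  module Glued {n k s σ τ} (shape : IsShape n (k , s , σ , τ)) where

    A Aᶜ u v : List ℕ
    A  = trues s
    Aᶜ = falses s
    u  = map (nth A) σ
    v  = map (nth Aᶜ) τ

    k≤n : k ≤ n
    k≤n = ≤-pred (proj₁ shape)

    |s| : length s ≡ n
    |s| = proj₁ (∈subsets⁻ n k (proj₁ (proj₂ shape)))

    |A| : length A ≡ k
    |A| = proj₂ (∈subsets⁻ n k (proj₁ (proj₂ shape)))

    |Aᶜ| : length Aᶜ ≡ n ∸ k
    |Aᶜ| = length-falses n k s |s| |A|

    σ-perm : IsPermWord k σ
    σ-perm = ∈permWords⁻ k (proj₁ (proj₂ (proj₂ shape)))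

    τ-perm : IsPermWord (n ∸ k) τ
    τ-perm = ∈permWords⁻ (n ∸ k) (proj₂ (proj₂ (proj₂ shape)))

    σ<|A| : All (_< length A) σ
    σ<|A| = subst (λ m → All (_< m) σ) (sym |A|) (proj₁ (proj₂ σ-perm))

    τ<|Aᶜ| : All (_< length Aᶜ) τ
    τ<|Aᶜ| = subst (λ m → All (_< m) τ) (sym |Aᶜ|) (proj₁ (proj₂ τ-perm))

    u↭A : u ↭ A
    u↭A = map-nth-permWord↭ k A σ-perm |A|

    v↭Aᶜ : v ↭ Aᶜ
    v↭Aᶜ = map-nth-permWord↭ (n ∸ k) Aᶜ τ-perm |Aᶜ|

    u⊆A : ∀ {x} → x ∈ u → x ∈ A
    u⊆A = ∈-resp-↭ u↭A

    A⊆u : ∀ {x} → x ∈ A → x ∈ u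
    A⊆u = ∈-resp-↭ (↭-sym u↭A)

    v⊆Aᶜ : ∀ {x} → x ∈ v → x ∈ Aᶜ
    v⊆Aᶜ = ∈-resp-↭ v↭Aᶜ

    u<n : All (_< n) u
    u<n = All.tabulate (λ x∈u → subst (_ <_) |s| (proj₁ (∈positions⁻ id s (u⊆A x∈u))))

    v<n : All (_< n) v
    v<n = All.tabulate (λ x∈v → subst (_ <_) |s| (proj₁ (∈positions⁻ not s (v⊆Aᶜ x∈v))))

    |u| : length u ≡ k
    |u| = trans (length-map _ σ) (proj₁ σ-perm)

    |v| : length v ≡ n ∸ k
    |v| = trans (length-map _ τ) (proj₁ τ-perm)

    u! : Unique u
    u! = map-nth-unique A (positions-unique id s) (proj₂ (proj₂ σ-perm)) σ<|A|

    v! : Unique v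
    v! = map-nth-unique Aᶜ (positions-unique not s) (proj₂ (proj₂ τ-perm)) τ<|Aᶜ|

    n∉u : n ∉ u
    n∉u n∈u = <-irrefl refl (All.lookup u<n n∈u)

    u∩v≡∅ : ∀ {x} → x ∈ u → x ∉ v
    u∩v≡∅ x∈u x∈v
      with () ← subst (λ b → not b ≡ true) (proj₂ (∈positions⁻ id s (u⊆A x∈u))) (proj₂ (∈positions⁻ not s (v⊆Aᶜ x∈v)))

    decompose-glue : decompose n (glue n (k , s , σ , τ)) ≡ (k , s , σ , τ)
    decompose-glue
      rewrite breakAt-++ n u v n∉u | memberBits-trues n s u |s| u⊆A A⊆u
            | map-indexOf-nth A (positions-unique id s) σ<|A| | map-indexOf-nth Aᶜ (positions-unique not s) τ<|Aᶜ|
            | |u| = refl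

    |glue| : length (glue n (k , s , σ , τ)) ≡ suc n
    |glue| = begin
      length (u ++ n ∷ v)        ≡⟨ length-++ u ⟩
      length u + suc (length v)  ≡⟨ cong₂ (λ a b → a + suc b) |u| |v| ⟩
      k + suc (n ∸ k)            ≡⟨ +-suc k (n ∸ k) ⟩
      suc (k + (n ∸ k))          ≡⟨ cong suc (m+[n∸m]≡n k≤n) ⟩
      suc n                      ∎
      where open ≡-Reasoning

    glue-permWord : glue n (k , s , σ , τ) ∈ permWords (suc n)
    glue-permWord = ∈permWords⁺ (suc n) (|glue| , glue<suc-n , glue!)
      where
      glue<suc-n : All (_< suc n) (glue n (k , s , σ , τ))
      glue<suc-n = All.++⁺ (All.map m<n⇒m<1+n u<n) (n<1+n n ∷ All.map m<n⇒m<1+n v<n)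
      glue! : Unique (glue n (k , s , σ , τ))
      glue! = Unique.++⁺ u! (All.map (λ x<n n≡x → <-irrefl (sym n≡x) x<n) v<n ∷ v!)
                λ { (x∈u , here refl) → n∉u x∈u ; (x∈u , there x∈v) → u∩v≡∅ x∈u x∈v }

  module Split {n w} (w∈ : w ∈ permWords (suc n)) where

    w-perm : IsPermWord (suc n) w
    w-perm = ∈permWords⁻ (suc n) w∈

    u v : List ℕ
    u = proj₁ (breakAt n w)
    v = proj₂ (breakAt n w)

    w≡u++n∷v : u ++ n ∷ v ≡ w
    w≡u++n∷v = breakAt-∈ n w (∈-resp-↭ (↭-sym (permWord↭upTo (suc n) w-perm)) (∈-upTo⁺ (n<1+n n)))

    private
      split! : Unique u × Unique (n ∷ v) × (∀ {x} → x ∈ u → x ∉ n ∷ v)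
      split! = unique-++⁻ u (subst Unique (sym w≡u++n∷v) (proj₂ (proj₂ w-perm)))
      split<suc-n : All (_< suc n) (u ++ n ∷ v)
      split<suc-n = subst (All (_< suc n)) (sym w≡u++n∷v) (proj₁ (proj₂ w-perm))

    u! : Unique u
    u! = proj₁ split!

    v! : Unique v
    v! with proj₁ (proj₂ split!)
    ... | _ ∷ v! = v!

    u∩v≡∅ : ∀ {x} → x ∈ u → x ∉ v
    u∩v≡∅ x∈u x∈v = proj₂ (proj₂ split!) x∈u (there x∈v)

    u<n : ∀ {x} → x ∈ u → x < n
    u<n x∈u = ≤∧≢⇒< (≤-pred (All.lookup split<suc-n (∈-++⁺ˡ x∈u))) (λ { refl → proj₂ (proj₂ split!) x∈u (here refl) })

    v<n : ∀ {x} → x ∈ v → x < n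
    v<n x∈v with proj₁ (proj₂ split!)
    ... | n∉v ∷ _ = ≤∧≢⇒< (≤-pred (All.lookup split<suc-n (∈-++⁺ʳ u (there x∈v)))) (λ x≡n → All.lookup n∉v x∈v (sym x≡n))

    k : ℕ
    k = length u

    k+|v|≡n : k + length v ≡ n
    k+|v|≡n = suc-injective (trans (sym (+-suc k (length v))) (trans (sym (length-++ u)) (trans (cong length w≡u++n∷v) (proj₁ w-perm))))

    S : List Bool
    S = memberBits n u

    A Aᶜ : List ℕ
    A  = trues S
    Aᶜ = falses S

    |S| : length S ≡ n
    |S| = length-applyUpTo _ n

    bit-S : ∀ {x} → x < n → bit S x ≡ does (x ∈? u)
    bit-S = bit-applyUpTo (λ x → does (x ∈? u)) n

    u⊆A : ∀ {x} → x ∈ u → x ∈ A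
    u⊆A {x} x∈u with x ∈? u in eq
    ... | yes _   = ∈positions⁺ id S (subst (x <_) (sym |S|) (u<n x∈u)) (trans (bit-S (u<n x∈u)) (cong does eq))
    ... | no  x∉u = ⊥-elim (x∉u x∈u)

    A⊆u : ∀ {x} → x ∈ A → x ∈ u
    A⊆u {x} x∈A with ∈positions⁻ id S x∈A
    ... | x<|S| , bit≡true with x ∈? u in eq
    ...   | yes x∈u = x∈u
    ...   | no  _   with () ← trans (sym (trans (bit-S (subst (x <_) |S| x<|S|)) (cong does eq))) bit≡true

    v⊆Aᶜ : ∀ {x} → x ∈ v → x ∈ Aᶜ
    v⊆Aᶜ {x} x∈v with x ∈? u in eq
    ... | yes x∈u = ⊥-elim (u∩v≡∅ x∈u x∈v)
    ... | no  _   = ∈positions⁺ not S (subst (x <_) (sym |S|) (v<n x∈v)) (cong not (trans (bit-S (v<n x∈v)) (cong does eq)))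

    |A| : length A ≡ k
    |A| = ↭-length (unique-sameElements⇒↭ (positions-unique id S) u! A⊆u u⊆A)

    |Aᶜ| : length Aᶜ ≡ n ∸ k
    |Aᶜ| = length-falses n k S |S| |A|

    |v| : length v ≡ n ∸ k
    |v| = trans (sym (m+n∸m≡n k (length v))) (cong (_∸ k) k+|v|≡n)

    decompose∈shapes : decompose n w ∈ shapes n
    decompose∈shapes = ∈shapes⁺ n
      ( s≤s (subst (k ≤_) k+|v|≡n (m≤m+n k (length v)))
      , ∈subsets⁺ n k S |S| |A|
      , map-indexOf-permWord k A u |A| u! u⊆A refl
      , map-indexOf-permWord (n ∸ k) Aᶜ v |Aᶜ| v! v⊆Aᶜ |v| )

    glue-decompose : glue n (decompose n w) ≡ w
    glue-decompose = trans (cong₂ (λ a b → a ++ n ∷ b) (map-nth-indexOf u u⊆A) (map-nth-indexOf v v⊆Aᶜ)) w≡u++n∷v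

  permWords↭glue-shapes : ∀ n → permWords (suc n) ↭ map (glue n) (shapes n)
  permWords↭glue-shapes n = unique-sameElements⇒↭ (permWords-unique (suc n)) glued!
    (λ {w} w∈ → subst (_∈ map (glue n) (shapes n)) (Split.glue-decompose w∈) (∈-map⁺ (glue n) (Split.decompose∈shapes w∈)))
    (λ w∈ → glued-permWord (∈-map⁻ (glue n) w∈))
    where
    glued! : Unique (map (glue n) (shapes n))
    glued! = unique-map⁺ (glue n) injective (shapes-unique n)
      where
      injective : ∀ {t t′} → t ∈ shapes n → t′ ∈ shapes n → glue n t ≡ glue n t′ → t ≡ t′
      injective t∈ t′∈ eq = trans (sym (Glued.decompose-glue (∈shapes⁻ n t∈)))
                              (trans (cong (decompose n) eq) (Glued.decompose-glue (∈shapes⁻ n t′∈)))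
    glued-permWord : ∀ {w} → ∃ (λ t → t ∈ shapes n × w ≡ glue n t) → w ∈ permWords (suc n)
    glued-permWord (_ , t∈ , refl) = Glued.glue-permWord (∈shapes⁻ n t∈)

module Weights where

  open import Data.Nat using (ℕ; suc; _+_; _∸_; _<_; _<ᵇ_)
  open import Data.Nat.Properties using (<⇒≤; +-0-commutativeMonoid)
  open import Data.Bool using (Bool; true; false; _∧_; not)
  open import Data.Bool.Properties using (∧-identityʳ; ∧-zeroʳ)
  open import Data.List using (List; []; _∷_; map; length)
  open import Data.List.Relation.Unary.All as All using (All)
  open import Data.Product using (_,_)
  open import Function using (id)
  open import Relation.Binary.PropositionalEquality

  open ListSum +-0-commutativeMonoid using (Σ; Σ-cong; Σ-cong-∈; Σ-↭; Σ-map; Σ-ε; Σ-distrib-∙)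
  open Words
  open Subsets
  open Decomposition

  ascentsAcross descentsAcross : List Bool → ℕ
  ascentsAcross  s = Σ (trues s) (λ a → Σ (falses s) (λ y → 𝟙 (a <ᵇ y)))
  descentsAcross s = Σ (trues s) (λ a → Σ (falses s) (λ y → 𝟙 (y <ᵇ a)))

  module _ {n k s σ τ} (shape : IsShape n (k , s , σ , τ)) where

    open Glued shape

    private
      A-<ᵇ : ∀ {i j} → i < length A → j < length A → (nth A i <ᵇ nth A j) ≡ (i <ᵇ j)
      A-<ᵇ = nth-<ᵇ A (positions-sorted id s)

      Aᶜ-<ᵇ : ∀ {i j} → i < length Aᶜ → j < length Aᶜ → (nth Aᶜ i <ᵇ nth Aᶜ j) ≡ (i <ᵇ j)
      Aᶜ-<ᵇ = nth-<ᵇ Aᶜ (positions-sorted not s)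

      across : ∀ (c : ℕ → ℕ → ℕ) → Σ u (λ a → Σ v (c a)) ≡ Σ A (λ a → Σ Aᶜ (c a))
      across c = trans (Σ-cong u (λ a → Σ-↭ (c a) v↭Aᶜ)) (Σ-↭ _ u↭A)

    s₁-glue : s₁ (glue n (k , s , σ , τ)) ≡ k + s₁ σ + s₁ τ
    s₁-glue = trans (s₁-++-max n u v u<n v<n)
                (cong₂ _+_ (cong₂ _+_ |u| (s₁-map A-<ᵇ σ σ<|A|)) (s₁-map Aᶜ-<ᵇ τ τ<|Aᶜ|))

    s₂-glue : s₂ (glue n (k , s , σ , τ)) ≡ (n ∸ k) + s₂ σ + s₂ τ
    s₂-glue = trans (s₂-++-max n u v u<n v<n)
                (cong₂ _+_ (cong₂ _+_ |v| (s₂-map A-<ᵇ σ σ<|A|)) (s₂-map Aᶜ-<ᵇ τ τ<|Aᶜ|))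

    t₁-glue : t₁ (glue n (k , s , σ , τ)) ≡ ascentsAcross s + t₁ σ + t₁ τ
    t₁-glue = trans (tripleStat-++-max V₁ n u v middle-max first-max u<n v<n)
                (cong₂ _+_ (cong₂ _+_ crossing (t₁-map A-<ᵇ σ σ<|A|)) (t₁-map Aᶜ-<ᵇ τ τ<|Aᶜ|))
      where
      middle-max : ∀ a x → a < n → x < n → V₁ a x n ≡ false
      middle-max a x _ x<n rewrite <ᵇ-false (<⇒≤ x<n) = ∧-zeroʳ _
      first-max : ∀ x y → x < n → y < n → V₁ n x y ≡ false
      first-max x y _ y<n rewrite <ᵇ-false (<⇒≤ y<n) = refl
      crossing : Σ u (λ a → Σ v (λ y → 𝟙 (V₁ a n y))) ≡ ascentsAcross s
      crossing = trans (Σ-cong u (λ a → Σ-cong-∈ v (λ {y} y∈v → cong 𝟙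
                   (trans (cong ((a <ᵇ y) ∧_) (<ᵇ-true (All.lookup v<n y∈v))) (∧-identityʳ _)))))
                   (across (λ a y → 𝟙 (a <ᵇ y)))

    t₂-glue : t₂ (glue n (k , s , σ , τ)) ≡ descentsAcross s + t₂ σ + t₂ τ
    t₂-glue = trans (tripleStat-++-max V₂ n u v middle-max first-max u<n v<n)
                (cong₂ _+_ (cong₂ _+_ crossing (t₂-map A-<ᵇ σ σ<|A|)) (t₂-map Aᶜ-<ᵇ τ τ<|Aᶜ|))
      where
      middle-max : ∀ a x → a < n → x < n → V₂ a x n ≡ false
      middle-max a x a<n _ rewrite <ᵇ-false (<⇒≤ a<n) = refl
      first-max : ∀ x y → x < n → y < n → V₂ n x y ≡ false
      first-max x y x<n _ rewrite <ᵇ-false (<⇒≤ x<n) = ∧-zeroʳ _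
      crossing : Σ u (λ a → Σ v (λ y → 𝟙 (V₂ a n y))) ≡ descentsAcross s
      crossing = trans (Σ-cong-∈ u (λ {a} a∈u → Σ-cong v (λ y → cong 𝟙
                   (trans (cong ((y <ᵇ a) ∧_) (<ᵇ-true (All.lookup u<n a∈u))) (∧-identityʳ _)))))
                   (across (λ a y → 𝟙 (y <ᵇ a)))

  private
    Σ-one : ∀ {A : Set} (xs : List A) → Σ xs (λ _ → 1) ≡ length xs
    Σ-one []       = refl
    Σ-one (x ∷ xs) = cong suc (Σ-one xs)

    Σ-suc² : ∀ (c : ℕ → ℕ → ℕ) s → Σ (map suc (trues s)) (λ a → Σ (map suc (falses s)) (c a))
                                  ≡ Σ (trues s) (λ a → Σ (falses s) (λ y → c (suc a) (suc y)))
    Σ-suc² c s = trans (Σ-map suc (trues s) _) (Σ-cong (trues s) (λ a → Σ-map suc (falses s) _))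

  ascentsAcross-true : ∀ s → ascentsAcross (true ∷ s) ≡ length (falses s) + ascentsAcross s
  ascentsAcross-true s = cong₂ _+_ (trans (Σ-map suc (falses s) _) (Σ-one (falses s))) (Σ-suc² _ s)

  ascentsAcross-false : ∀ s → ascentsAcross (false ∷ s) ≡ ascentsAcross s
  ascentsAcross-false s = Σ-suc² _ s

  descentsAcross-true : ∀ s → descentsAcross (true ∷ s) ≡ descentsAcross s
  descentsAcross-true s = cong₂ _+_ (trans (Σ-map suc (falses s) _) (Σ-ε (falses s))) (Σ-suc² _ s)

  descentsAcross-false : ∀ s → descentsAcross (false ∷ s) ≡ length (trues s) + descentsAcross s
  descentsAcross-false s = trans (Σ-map suc (trues s) _)
    (trans (Σ-distrib-∙ (trues s) (λ _ → 1) _)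
           (cong₂ _+_ (Σ-one (trues s)) (Σ-cong (trues s) (λ a → Σ-map suc (falses s) _))))

module Ring {c ℓ} (R : CommutativeRing c ℓ) (p₁ p₂ q₁ q₂ : CommutativeRing.Carrier R) where

  open import Data.Nat as ℕ using (ℕ; zero; suc; _∸_; s≤s)
  import Data.Nat.Properties as ℕ
  open import Data.Bool using (Bool; true; false)
  open import Data.List using (List; []; _∷_; map; upTo; applyUpTo; length; _++_)
  open import Data.List.Properties using (map-upTo)
  open import Data.List.Membership.Propositional using (_∈_)
  open import Data.List.Membership.Propositional.Properties using (∈-upTo⁻)
  open import Data.Product using (_,_; proj₁; proj₂)
  open import Data.Sum using (inj₁; inj₂)
  import Algebra.Bundles
  open import Function using (_∘_)
  import Relation.Binary.PropositionalEquality as ≡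
  open ≡ using (_≡_)
  open Words using (word; s₁; s₂; t₁; t₂; S₁≡s₁; S₂≡s₂; T₁≡t₁; T₂≡t₂)
  open Subsets using (subsets; subsets-empty; ∈subsets⁻; trues; falses; length-falses)
  open PermWords using (permWords)
  open Lists using (dependentPairs)
  open Decomposition using (Shape; shapes; IsShape; glue; permWords↭glue-shapes)
  open Weights

  open CommutativeRing R
  open Setup R p₁ p₂ q₁ q₂
  open import Algebra.Properties.RingWithoutOne (Algebra.Bundles.Ring.ringWithoutOne ring) using (x[y-z]≈xy-xz; [y-z]x≈yx-zx)
  open import Algebra.Solver.Ring.NaturalCoefficients.Default commutativeSemiring
  open import Relation.Binary.Reasoning.Setoid setoid
  open ListSum +-commutativeMonoid hiding (Σ)

  private variable A B : Set

  Σ-*ˡ : ∀ a (xs : List A) (f : A → Carrier) → a * Σ xs f ≈ Σ xs (λ x → a * f x)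
  Σ-*ˡ a []       f = zeroʳ a
  Σ-*ˡ a (x ∷ xs) f = trans (distribˡ a _ _) (+-congˡ (Σ-*ˡ a xs f))

  Σ-*ʳ : ∀ a (xs : List A) (f : A → Carrier) → Σ xs f * a ≈ Σ xs (λ x → f x * a)
  Σ-*ʳ a xs f = trans (*-comm _ a) (trans (Σ-*ˡ a xs f) (Σ-cong xs (λ x → *-comm a (f x))))

  Σ-product : ∀ (xs : List A) (ys : List B) f g → Σ xs (λ x → Σ ys (λ y → f x * g y)) ≈ Σ xs f * Σ ys g
  Σ-product xs ys f g = trans (Σ-cong xs (λ x → sym (Σ-*ˡ (f x) ys g))) (sym (Σ-*ʳ (Σ ys g) xs f))

  Σ-scaled-product : ∀ a (xs : List A) (ys : List B) f g →
                     Σ xs (λ x → Σ ys (λ y → a * (f x * g y))) ≈ a * (Σ xs f * Σ ys g)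
  Σ-scaled-product a xs ys f g = trans (Σ-cong xs (λ x → sym (Σ-*ˡ a ys (λ y → f x * g y))))
                                   (trans (sym (Σ-*ˡ a xs _)) (*-congˡ (Σ-product xs ys f g)))

  pow-+ : ∀ x a b → pow x (a ℕ.+ b) ≈ pow x a * pow x b
  pow-+ x zero    b = sym (*-identityˡ _)
  pow-+ x (suc a) b = trans (*-congˡ (pow-+ x a b)) (sym (*-assoc _ _ _))

  monomial : ℕ → ℕ → ℕ → ℕ → Carrier
  monomial a b c d = pow p₁ a * pow p₂ b * pow q₁ c * pow q₂ d

  monomial-+ : ∀ a b c d a′ b′ c′ d′ →
    monomial (a ℕ.+ a′) (b ℕ.+ b′) (c ℕ.+ c′) (d ℕ.+ d′) ≈ monomial a b c d * monomial a′ b′ c′ d′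
  monomial-+ a b c d a′ b′ c′ d′ = begin
    monomial (a ℕ.+ a′) (b ℕ.+ b′) (c ℕ.+ c′) (d ℕ.+ d′)
      ≈⟨ *-cong (*-cong (*-cong (pow-+ p₁ a a′) (pow-+ p₂ b b′)) (pow-+ q₁ c c′)) (pow-+ q₂ d d′) ⟩
    (pow p₁ a * pow p₁ a′) * (pow p₂ b * pow p₂ b′) * (pow q₁ c * pow q₁ c′) * (pow q₂ d * pow q₂ d′)
      ≈⟨ solve 8 (λ a a′ b b′ c c′ d d′ → (a :* a′) :* (b :* b′) :* (c :* c′) :* (d :* d′)
                                          := (a :* b :* c :* d) :* (a′ :* b′ :* c′ :* d′)) refl
               (pow p₁ a) (pow p₁ a′) (pow p₂ b) (pow p₂ b′) (pow q₁ c) (pow q₁ c′) (pow q₂ d) (pow q₂ d′) ⟩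
    monomial a b c d * monomial a′ b′ c′ d′ ∎

  monomial-cong : ∀ {a b c d a′ b′ c′ d′} → a ≡ a′ → b ≡ b′ → c ≡ c′ → d ≡ d′ → monomial a b c d ≈ monomial a′ b′ c′ d′
  monomial-cong ≡.refl ≡.refl ≡.refl ≡.refl = refl

  weight : List ℕ → Carrier
  weight w = monomial (s₁ w) (s₂ w) (t₁ w) (t₂ w)

  F≈Σweight : ∀ n → F n ≈ Σ (permWords n) weight
  F≈Σweight n = sym (trans (Σ-map word (perms n) weight) (Σ-cong (perms n) (λ π →
    monomial-cong (≡.sym (S₁≡s₁ π)) (≡.sym (S₂≡s₂ π)) (≡.sym (T₁≡t₁ π)) (≡.sym (T₂≡t₂ π)))))

  subsetWeight : List Bool → Carrier
  subsetWeight s = pow q₁ (ascentsAcross s) * pow q₂ (descentsAcross s)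

  qbinomᶜ : ℕ → ℕ → Carrier
  qbinomᶜ n k = Σ (subsets n k) subsetWeight

  weight-glue : ∀ {n k s σ τ} → IsShape n (k , s , σ , τ) →
                weight (glue n (k , s , σ , τ)) ≈ (subsetWeight s * (pow p₁ k * pow p₂ (n ∸ k))) * (weight σ * weight τ)
  weight-glue {n} {k} {s} {σ} {τ} shape = begin
    weight (glue n (k , s , σ , τ))
      ≈⟨ monomial-cong (s₁-glue shape) (s₂-glue shape) (t₁-glue shape) (t₂-glue shape) ⟩
    monomial (k ℕ.+ s₁ σ ℕ.+ s₁ τ) (n ∸ k ℕ.+ s₂ σ ℕ.+ s₂ τ)
             (ascentsAcross s ℕ.+ t₁ σ ℕ.+ t₁ τ) (descentsAcross s ℕ.+ t₂ σ ℕ.+ t₂ τ)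
      ≈⟨ monomial-+ (k ℕ.+ s₁ σ) (n ∸ k ℕ.+ s₂ σ) (ascentsAcross s ℕ.+ t₁ σ) (descentsAcross s ℕ.+ t₂ σ) (s₁ τ) (s₂ τ) (t₁ τ) (t₂ τ) ⟩
    monomial (k ℕ.+ s₁ σ) (n ∸ k ℕ.+ s₂ σ) (ascentsAcross s ℕ.+ t₁ σ) (descentsAcross s ℕ.+ t₂ σ) * weight τ
      ≈⟨ *-congʳ (monomial-+ k (n ∸ k) (ascentsAcross s) (descentsAcross s) (s₁ σ) (s₂ σ) (t₁ σ) (t₂ σ)) ⟩
    monomial k (n ∸ k) (ascentsAcross s) (descentsAcross s) * weight σ * weight τ
      ≈⟨ solve 6 (λ a b c d x y → a :* b :* c :* d :* x :* y := (c :* d :* (a :* b)) :* (x :* y)) refl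
               (pow p₁ k) (pow p₂ (n ∸ k)) (pow q₁ (ascentsAcross s)) (pow q₂ (descentsAcross s)) (weight σ) (weight τ) ⟩
    (subsetWeight s * (pow p₁ k * pow p₂ (n ∸ k))) * (weight σ * weight τ) ∎

  Σ-shapes : ∀ n (f : Shape → Carrier) →
    Σ (shapes n) f ≈ Σ≤ n λ k → Σ (subsets n k) λ s → Σ (permWords k) λ σ → Σ (permWords (n ∸ k)) λ τ → f (k , s , σ , τ)
  Σ-shapes n f =
    trans (Σ-dependentPairs (upTo (suc n)) (λ k → dependentPairs (subsets n k) (λ _ → dependentPairs (permWords k) (λ _ → permWords (n ∸ k)))) f)
      (Σ-cong (upTo (suc n)) λ k →
    trans (Σ-dependentPairs (subsets n k) (λ _ → dependentPairs (permWords k) (λ _ → permWords (n ∸ k))) (λ p → f (k , p)))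
      (Σ-cong (subsets n k) λ s →
    Σ-dependentPairs (permWords k) (λ _ → permWords (n ∸ k)) (λ p → f (k , s , p))))

  F-suc : ∀ n → F (suc n) ≈ Σ≤ n (λ k → qbinomᶜ n k * (pow p₁ k * pow p₂ (n ∸ k)) * (F k * F (n ∸ k)))
  F-suc n = begin
    F (suc n)                           ≈⟨ F≈Σweight (suc n) ⟩
    Σ (permWords (suc n)) weight        ≈⟨ Σ-↭ weight (permWords↭glue-shapes n) ⟩
    Σ (map (glue n) (shapes n)) weight  ≈⟨ Σ-map (glue n) (shapes n) weight ⟩
    Σ (shapes n) (weight ∘ glue n)      ≈⟨ Σ-shapes n (weight ∘ glue n) ⟩
    Σ≤ n (λ k → Σ (subsets n k) λ s → Σ (permWords k) λ σ → Σ (permWords (n ∸ k)) λ τ → weight (glue n (k , s , σ , τ)))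
      ≈⟨ Σ-cong-∈ (upTo (suc n)) (λ k∈ → summand (∈-upTo⁻ k∈)) ⟩
    Σ≤ n (λ k → qbinomᶜ n k * (pow p₁ k * pow p₂ (n ∸ k)) * (F k * F (n ∸ k))) ∎
    where
    summand : ∀ {k} → k ℕ.< suc n →
      Σ (subsets n k) (λ s → Σ (permWords k) λ σ → Σ (permWords (n ∸ k)) λ τ → weight (glue n (k , s , σ , τ)))
      ≈ qbinomᶜ n k * (pow p₁ k * pow p₂ (n ∸ k)) * (F k * F (n ∸ k))
    summand {k} k< = begin
      Σ (subsets n k) (λ s → Σ (permWords k) λ σ → Σ (permWords (n ∸ k)) λ τ → weight (glue n (k , s , σ , τ)))
        ≈⟨ Σ-cong-∈ (subsets n k) (λ s∈ → Σ-cong-∈ (permWords k) (λ σ∈ → Σ-cong-∈ (permWords (n ∸ k)) (λ τ∈ →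
             weight-glue (k< , s∈ , σ∈ , τ∈)))) ⟩
      Σ (subsets n k) (λ s → Σ (permWords k) λ σ → Σ (permWords (n ∸ k)) λ τ → (subsetWeight s * P) * (weight σ * weight τ))
        ≈⟨ Σ-cong (subsets n k) (λ s → Σ-scaled-product (subsetWeight s * P) (permWords k) (permWords (n ∸ k)) weight weight) ⟩
      Σ (subsets n k) (λ s → (subsetWeight s * P) * (Σ (permWords k) weight * Σ (permWords (n ∸ k)) weight))
        ≈⟨ sym (Σ-*ʳ _ (subsets n k) _) ⟩
      Σ (subsets n k) (λ s → subsetWeight s * P) * (Σ (permWords k) weight * Σ (permWords (n ∸ k)) weight)
        ≈⟨ *-cong (sym (Σ-*ʳ P (subsets n k) subsetWeight)) (*-cong (sym (F≈Σweight k)) (sym (F≈Σweight (n ∸ k)))) ⟩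
      qbinomᶜ n k * P * (F k * F (n ∸ k)) ∎
      where
      P : Carrier
      P = pow p₁ k * pow p₂ (n ∸ k)

  qint-suc : ∀ m → qint (suc m) ≈ pow q₁ m + q₂ * qint m
  qint-suc m = +-cong (*-identityʳ _) (begin
    Σ (applyUpTo suc m) term    ≡⟨ ≡.cong (λ xs → Σ xs term) (≡.sym (map-upTo suc m)) ⟩
    Σ (map suc (upTo m)) term             ≈⟨ Σ-map suc (upTo m) term ⟩
    Σ (upTo m) (λ i → pow q₁ (m ∸ suc i) * (q₂ * pow q₂ i))
      ≈⟨ Σ-cong (upTo m) (λ i → solve 3 (λ a b c → a :* (b :* c) := b :* (a :* c)) refl _ _ _) ⟩
    Σ (upTo m) (λ i → q₂ * (pow q₁ (m ∸ suc i) * pow q₂ i)) ≈⟨ sym (Σ-*ˡ q₂ (upTo m) _) ⟩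
    q₂ * qint m ∎)
    where
    term : ℕ → Carrier
    term i = pow q₁ (suc m ∸ suc i) * pow q₂ i

  qint-+ : ∀ a b → qint (a ℕ.+ b) ≈ pow q₁ b * qint a + pow q₂ a * qint b
  qint-+ zero    b = sym (trans (+-cong (zeroʳ _) (*-identityˡ _)) (+-identityˡ _))
  qint-+ (suc a) b = begin
    qint (suc (a ℕ.+ b))                                                ≈⟨ qint-suc (a ℕ.+ b) ⟩
    pow q₁ (a ℕ.+ b) + q₂ * qint (a ℕ.+ b)                              ≈⟨ +-cong (pow-+ q₁ a b) (*-congˡ (qint-+ a b)) ⟩
    pow q₁ a * pow q₁ b + q₂ * (pow q₁ b * qint a + pow q₂ a * qint b)
      ≈⟨ solve 6 (λ x y z t u v → x :* y :+ z :* (y :* t :+ u :* v) := y :* (x :+ z :* t) :+ (z :* u) :* v) refl _ _ _ _ _ _ ⟩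
    pow q₁ b * (pow q₁ a + q₂ * qint a) + (q₂ * pow q₂ a) * qint b      ≈⟨ +-congʳ (*-congˡ (sym (qint-suc a))) ⟩
    pow q₁ b * qint (suc a) + pow q₂ (suc a) * qint b                   ∎

  subsetWeight-false : ∀ s {j} → length (trues s) ≡ j → subsetWeight (false ∷ s) ≈ pow q₂ j * subsetWeight s
  subsetWeight-false s ≡.refl = begin
    pow q₁ (ascentsAcross (false ∷ s)) * pow q₂ (descentsAcross (false ∷ s))
      ≡⟨ ≡.cong₂ (λ a d → pow q₁ a * pow q₂ d) (ascentsAcross-false s) (descentsAcross-false s) ⟩
    pow q₁ (ascentsAcross s) * pow q₂ (length (trues s) ℕ.+ descentsAcross s)  ≈⟨ *-congˡ (pow-+ q₂ (length (trues s)) (descentsAcross s)) ⟩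
    pow q₁ (ascentsAcross s) * (pow q₂ (length (trues s)) * pow q₂ (descentsAcross s))
      ≈⟨ solve 3 (λ a b c → a :* (b :* c) := b :* (a :* c)) refl (pow q₁ (ascentsAcross s)) (pow q₂ (length (trues s))) (pow q₂ (descentsAcross s)) ⟩
    pow q₂ (length (trues s)) * subsetWeight s ∎

  subsetWeight-true : ∀ s {j} → length (falses s) ≡ j → subsetWeight (true ∷ s) ≈ pow q₁ j * subsetWeight s
  subsetWeight-true s ≡.refl = begin
    pow q₁ (ascentsAcross (true ∷ s)) * pow q₂ (descentsAcross (true ∷ s))
      ≡⟨ ≡.cong₂ (λ a d → pow q₁ a * pow q₂ d) (ascentsAcross-true s) (descentsAcross-true s) ⟩
    pow q₁ (length (falses s) ℕ.+ ascentsAcross s) * pow q₂ (descentsAcross s)  ≈⟨ *-congʳ (pow-+ q₁ (length (falses s)) (ascentsAcross s)) ⟩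
    (pow q₁ (length (falses s)) * pow q₁ (ascentsAcross s)) * pow q₂ (descentsAcross s)  ≈⟨ *-assoc _ _ _ ⟩
    pow q₁ (length (falses s)) * subsetWeight s ∎

  qbinomᶜ-empty : ∀ n k → n ℕ.< k → qbinomᶜ n k ≈ 0#
  qbinomᶜ-empty n k n<k rewrite subsets-empty n k n<k = refl

  qbinomᶜ-zero : ∀ n → qbinomᶜ n 0 ≈ 1#
  qbinomᶜ-zero zero    = trans (+-identityʳ _) (*-identityˡ 1#)
  qbinomᶜ-zero (suc n) = begin
    Σ (map (false ∷_) (subsets n 0)) subsetWeight  ≈⟨ Σ-map (false ∷_) (subsets n 0) subsetWeight ⟩
    Σ (subsets n 0) (subsetWeight ∘ (false ∷_))
      ≈⟨ Σ-cong-∈ (subsets n 0) (λ {s} s∈ → trans (subsetWeight-false s (proj₂ (∈subsets⁻ n 0 s∈))) (*-identityˡ _)) ⟩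
    qbinomᶜ n 0                                    ≈⟨ qbinomᶜ-zero n ⟩
    1#                                             ∎

  qbinomᶜ-suc : ∀ n k → qbinomᶜ (suc n) (suc k) ≈ pow q₂ (suc k) * qbinomᶜ n (suc k) + pow q₁ (n ∸ k) * qbinomᶜ n k
  qbinomᶜ-suc n k = begin
    Σ (map (false ∷_) (subsets n (suc k)) ++ map (true ∷_) (subsets n k)) subsetWeight
      ≈⟨ Σ-++ (map (false ∷_) (subsets n (suc k))) _ subsetWeight ⟩
    Σ (map (false ∷_) (subsets n (suc k))) subsetWeight + Σ (map (true ∷_) (subsets n k)) subsetWeight
      ≈⟨ +-cong (Σ-map (false ∷_) (subsets n (suc k)) subsetWeight) (Σ-map (true ∷_) (subsets n k) subsetWeight) ⟩
    Σ (subsets n (suc k)) (subsetWeight ∘ (false ∷_)) + Σ (subsets n k) (subsetWeight ∘ (true ∷_))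
      ≈⟨ +-cong (trans (Σ-cong-∈ (subsets n (suc k)) (λ {s} s∈ → subsetWeight-false s (proj₂ (∈subsets⁻ n (suc k) s∈))))
                       (sym (Σ-*ˡ _ (subsets n (suc k)) subsetWeight)))
                (trans (Σ-cong-∈ (subsets n k) (λ {s} s∈ → subsetWeight-true s (|complement| s∈)))
                       (sym (Σ-*ˡ _ (subsets n k) subsetWeight))) ⟩
    pow q₂ (suc k) * qbinomᶜ n (suc k) + pow q₁ (n ∸ k) * qbinomᶜ n k ∎
    where
    |complement| : ∀ {s} → s ∈ subsets n k → length (falses s) ≡ n ∸ k
    |complement| {s} s∈ = length-falses n k s (proj₁ (∈subsets⁻ n k s∈)) (proj₂ (∈subsets⁻ n k s∈))

  qbinomᶜ-factorials : ∀ n k → k ℕ.≤ n → qbinomᶜ n k * (qfact k * qfact (n ∸ k)) ≈ qfact n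
  qbinomᶜ-factorials zero    zero    _ = trans (*-congʳ (qbinomᶜ-zero 0)) (trans (*-identityˡ _) (*-identityˡ 1#))
  qbinomᶜ-factorials (suc n) zero    _ = trans (*-congʳ (qbinomᶜ-zero (suc n))) (trans (*-identityˡ _) (*-identityˡ _))
  qbinomᶜ-factorials (suc n) (suc k) (s≤s k≤n) = begin
    qbinomᶜ (suc n) (suc k) * (qfact k * [k+1] * [n-k]!)
      ≈⟨ *-congʳ (qbinomᶜ-suc n k) ⟩
    (pow q₂ (suc k) * qbinomᶜ n (suc k) + pow q₁ (n ∸ k) * qbinomᶜ n k) * (qfact k * [k+1] * [n-k]!)
      ≈⟨ solve 7 (λ a b c d e f g → (a :* b :+ c :* d) :* (e :* f :* g) := a :* (b :* (e :* f :* g)) :+ c :* (d :* (e :* f :* g)))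
               refl _ _ _ _ _ _ _ ⟩
    pow q₂ (suc k) * (qbinomᶜ n (suc k) * (qfact k * [k+1] * [n-k]!)) + pow q₁ (n ∸ k) * (qbinomᶜ n k * (qfact k * [k+1] * [n-k]!))
      ≈⟨ +-cong (*-congˡ upper) (*-congˡ lower) ⟩
    pow q₂ (suc k) * (qfact n * qint (n ∸ k)) + pow q₁ (n ∸ k) * (qfact n * [k+1])
      ≈⟨ solve 5 (λ a b c d e → a :* (b :* c) :+ d :* (b :* e) := b :* (d :* e :+ a :* c)) refl _ _ _ _ _ ⟩
    qfact n * (pow q₁ (n ∸ k) * [k+1] + pow q₂ (suc k) * qint (n ∸ k))  ≈⟨ *-congˡ (sym (qint-+ (suc k) (n ∸ k))) ⟩
    qfact n * qint (suc k ℕ.+ (n ∸ k))  ≡⟨ ≡.cong (λ m → qfact n * qint (suc m)) (ℕ.m+[n∸m]≡n k≤n) ⟩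
    qfact (suc n) ∎
    where
    [k+1] [n-k]! : Carrier
    [k+1] = qint (suc k)
    [n-k]! = qfact (n ∸ k)
    lower : qbinomᶜ n k * (qfact k * [k+1] * [n-k]!) ≈ qfact n * [k+1]
    lower = trans (solve 4 (λ a b c d → a :* (b :* c :* d) := a :* (b :* d) :* c) refl _ _ _ _)
                  (*-congʳ (qbinomᶜ-factorials n k k≤n))
    -- [n-k]! = [n-(k+1)]! [n-k] when k < n; when k = n the coefficient vanishes.
    upper : qbinomᶜ n (suc k) * (qfact k * [k+1] * [n-k]!) ≈ qfact n * qint (n ∸ k)
    upper with ℕ.m≤n⇒m<n∨m≡n k≤n
    ... | inj₁ k<n rewrite ℕ.+-∸-assoc 1 k<n =
          trans (solve 5 (λ a b c d e → a :* (b :* c :* (d :* e)) := a :* (b :* c :* d) :* e) refl _ _ _ _ _)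
                (*-congʳ (qbinomᶜ-factorials n (suc k) k<n))
    ... | inj₂ ≡.refl rewrite ℕ.n∸n≡0 k =
          trans (*-congʳ (qbinomᶜ-empty k (suc k) (ℕ.n<1+n k))) (trans (zeroˡ _) (sym (zeroʳ _)))

  telescope : ∀ x y z → (x - y) + (y - z) ≈ x - z
  telescope x y z = begin
    (x - y) + (y - z)          ≈⟨ solve 4 (λ x y y′ z′ → (x :+ y′) :+ (y :+ z′) := (x :+ z′) :+ (y :+ y′)) refl x y (- y) (- z) ⟩
    (x - z) + (y - y)          ≈⟨ +-congˡ (-‿inverseʳ y) ⟩
    (x - z) + 0#               ≈⟨ +-identityʳ _ ⟩
    x - z                      ∎

  pow-difference : ∀ m → pow q₁ m - pow q₂ m ≈ (q₁ - q₂) * qint m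
  pow-difference zero    = trans (-‿inverseʳ 1#) (sym (zeroʳ _))
  pow-difference (suc m) = begin
    q₁ * pow q₁ m - q₂ * pow q₂ m
      ≈⟨ sym (telescope _ (q₂ * pow q₁ m) _) ⟩
    (q₁ * pow q₁ m - q₂ * pow q₁ m) + (q₂ * pow q₁ m - q₂ * pow q₂ m)
      ≈⟨ +-cong (sym ([y-z]x≈yx-zx (pow q₁ m) q₁ q₂)) (sym (x[y-z]≈xy-xz q₂ (pow q₁ m) (pow q₂ m))) ⟩
    (q₁ - q₂) * pow q₁ m + q₂ * (pow q₁ m - pow q₂ m)
      ≈⟨ +-congˡ (*-congˡ (pow-difference m)) ⟩
    (q₁ - q₂) * pow q₁ m + q₂ * ((q₁ - q₂) * qint m)
      ≈⟨ solve 4 (λ d a b c → d :* a :+ b :* (d :* c) := d :* (a :+ b :* c)) refl (q₁ - q₂) (pow q₁ m) q₂ (qint m) ⟩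
    (q₁ - q₂) * (pow q₁ m + q₂ * qint m)
      ≈⟨ *-congˡ (sym (qint-suc m)) ⟩
    (q₁ - q₂) * qint (suc m) ∎

  qderiv-coefficient : ∀ d → (q₁ - q₂) * d ≈ 1# → ∀ f n → qderiv d f n ≈ qint (suc n) * f (suc n)
  qderiv-coefficient d d-inverse f n = begin
    d * (pow q₁ (suc n) * x - pow q₂ (suc n) * x)   ≈⟨ *-congˡ (sym ([y-z]x≈yx-zx x _ _)) ⟩
    d * ((pow q₁ (suc n) - pow q₂ (suc n)) * x)     ≈⟨ *-congˡ (*-congʳ (pow-difference (suc n))) ⟩
    d * ((q₁ - q₂) * qint (suc n) * x)
      ≈⟨ solve 4 (λ d a b x → d :* (a :* b :* x) := (a :* d) :* (b :* x)) refl d (q₁ - q₂) (qint (suc n)) x ⟩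
    ((q₁ - q₂) * d) * (qint (suc n) * x)            ≈⟨ *-congʳ d-inverse ⟩
    1# * (qint (suc n) * x)                          ≈⟨ *-identityˡ _ ⟩
    qint (suc n) * x                                 ∎
    where
    x : Carrier
    x = f (suc n)

  module WithInverses (inv : ℕ → Carrier) (inv-qint : ∀ m → qint (suc m) * inv m ≈ 1#) where

    qfact-invfact : ∀ m → qfact m * invfact inv m ≈ 1#
    qfact-invfact zero    = *-identityˡ 1#
    qfact-invfact (suc m) = begin
      qfact m * qint (suc m) * (invfact inv m * inv m)
        ≈⟨ solve 4 (λ a b c d → a :* b :* (c :* d) := (a :* c) :* (b :* d)) refl _ _ _ _ ⟩
      (qfact m * invfact inv m) * (qint (suc m) * inv m)  ≈⟨ *-cong (qfact-invfact m) (inv-qint m) ⟩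
      1# * 1#                                              ≈⟨ *-identityˡ 1# ⟩
      1#                                                   ∎

    qbinom≈qbinomᶜ : ∀ n k → k ℕ.≤ n → qbinom inv n k ≈ qbinomᶜ n k
    qbinom≈qbinomᶜ n k k≤n = begin
      qfact n * (invfact inv k * invfact inv (n ∸ k))
        ≈⟨ *-congʳ (sym (qbinomᶜ-factorials n k k≤n)) ⟩
      qbinomᶜ n k * (qfact k * qfact (n ∸ k)) * (invfact inv k * invfact inv (n ∸ k))
        ≈⟨ solve 5 (λ a b c d e → a :* (b :* c) :* (d :* e) := a :* ((b :* d) :* (c :* e))) refl _ _ _ _ _ ⟩
      qbinomᶜ n k * ((qfact k * invfact inv k) * (qfact (n ∸ k) * invfact inv (n ∸ k)))
        ≈⟨ *-congˡ (*-cong (qfact-invfact k) (qfact-invfact (n ∸ k))) ⟩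
      qbinomᶜ n k * (1# * 1#)  ≈⟨ *-congˡ (*-identityˡ 1#) ⟩
      qbinomᶜ n k * 1#         ≈⟨ *-identityʳ _ ⟩
      qbinomᶜ n k              ∎

    F-recurrence : ∀ n → F (suc n) ≈ Σ≤ n (λ k → qbinom inv n k * pow p₁ k * pow p₂ (n ∸ k) * F k * F (n ∸ k))
    F-recurrence n = trans (F-suc n) (Σ-cong-∈ (upTo (suc n)) λ {k} k∈ →
      trans (solve 5 (λ a b c d e → a :* (b :* c) :* (d :* e) := a :* b :* c :* d :* e) refl _ _ _ _ _)
            (*-congʳ (*-congʳ (*-congʳ (*-congʳ (sym (qbinom≈qbinomᶜ n k (ℕ.≤-pred (∈-upTo⁻ k∈)))))))))

    qint-𝓕 : ∀ n → qint (suc n) * 𝓕 inv (suc n) ≈ F (suc n) * invfact inv n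
    qint-𝓕 n = begin
      qint (suc n) * (F (suc n) * (invfact inv n * inv n))
        ≈⟨ solve 4 (λ a b c e → a :* (b :* (c :* e)) := b :* c :* (a :* e)) refl _ _ _ _ ⟩
      F (suc n) * invfact inv n * (qint (suc n) * inv n)  ≈⟨ *-congˡ (inv-qint n) ⟩
      F (suc n) * invfact inv n * 1#                      ≈⟨ *-identityʳ _ ⟩
      F (suc n) * invfact inv n                           ∎

    product-coefficient : ∀ n k →
      qbinom inv n k * pow p₁ k * pow p₂ (n ∸ k) * F k * F (n ∸ k) * invfact inv n
      ≈ scale p₁ (𝓕 inv) k * scale p₂ (𝓕 inv) (n ∸ k)
    product-coefficient n k = begin
      qfact n * (invfact inv k * invfact inv (n ∸ k)) * pow p₁ k * pow p₂ (n ∸ k) * F k * F (n ∸ k) * invfact inv n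
        ≈⟨ solve 8 (λ a b c d e f h i → a :* (b :* c) :* d :* e :* f :* h :* i
                                     := (a :* i) :* ((d :* (f :* b)) :* (e :* (h :* c)))) refl _ _ _ _ _ _ _ _ ⟩
      (qfact n * invfact inv n) * (scale p₁ (𝓕 inv) k * scale p₂ (𝓕 inv) (n ∸ k))
        ≈⟨ *-congʳ (qfact-invfact n) ⟩
      1# * (scale p₁ (𝓕 inv) k * scale p₂ (𝓕 inv) (n ∸ k))  ≈⟨ *-identityˡ _ ⟩
      scale p₁ (𝓕 inv) k * scale p₂ (𝓕 inv) (n ∸ k)        ∎

    qderiv-𝓕 : ∀ d → (q₁ - q₂) * d ≈ 1# → ∀ n → qderiv d (𝓕 inv) n ≈ (scale p₁ (𝓕 inv) · scale p₂ (𝓕 inv)) n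
    qderiv-𝓕 d d-inverse n = begin
      qderiv d (𝓕 inv) n                   ≈⟨ qderiv-coefficient d d-inverse (𝓕 inv) n ⟩
      qint (suc n) * 𝓕 inv (suc n)         ≈⟨ qint-𝓕 n ⟩
      F (suc n) * invfact inv n            ≈⟨ *-congʳ (F-recurrence n) ⟩
      Σ≤ n term * invfact inv n            ≈⟨ Σ-*ʳ (invfact inv n) (upTo (suc n)) term ⟩
      Σ≤ n (λ k → term k * invfact inv n)  ≈⟨ Σ-cong (upTo (suc n)) (product-coefficient n) ⟩
      (scale p₁ (𝓕 inv) · scale p₂ (𝓕 inv)) n ∎
      where
      term : ℕ → Carrier
      term k = qbinom inv n k * pow p₁ k * pow p₂ (n ∸ k) * F k * F (n ∸ k)

mainTheorem8 : ∀ {c ℓ} (R : CommutativeRing c ℓ) (p₁ p₂ q₁ q₂ : CommutativeRing.Carrier R)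
               (inv : ℕ → CommutativeRing.Carrier R) →
               let open CommutativeRing R
                   open Setup R p₁ p₂ q₁ q₂
               in (∀ m → qint (suc m) * inv m ≈ 1#) →
                  (∀ n → F (suc n) ≈ Σ≤ n (λ k → qbinom inv n k * pow p₁ k * pow p₂ (n ∸ k) * F k * F (n ∸ k)))
                  × (∀ (d : Carrier) → (q₁ - q₂) * d ≈ 1# →
                       ∀ n → qderiv d (𝓕 inv) n ≈ (scale p₁ (𝓕 inv) · scale p₂ (𝓕 inv)) n)
mainTheorem8 R p₁ p₂ q₁ q₂ inv inv-qint = F-recurrence , qderiv-𝓕
  where open Ring.WithInverses R p₁ p₂ q₁ q₂ inv inv-qint
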